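{- Let $d$ and $\eta$ be positive integers. Let $G$ be a graph with maximum degree at most $d$, and let $(T,(X_t:t\in V(T)))$ be a tree-decomposition of $G$ of adhesion at most $\eta$. Then there exists a tree-cut decomposition $(T',(X'_t:t\in V(T')))$ of $G$ of adhesion at most $(d+1)^2\eta+d$ such that: \begin{enumerate} \item $T'$ is obtained from $T$ by attaching leaves; \item for every $t\in V(T')$, $|X'_t|\le 1$, and if $|X'_t|=1$ then $t$ is a leaf of $T'$; \item for every $t\in V(T)$, the torso at $t$ in $(T',(X'_t))$ is a subgraph of a graph $R_t$ obtained from a subgraph of the torso at $t$ in $(T,(X_t))$ by identifying a set of at most $\eta$ vertices of $X_t$ into a single vertex, adding a set $I$ of new vertices, and adding edges incident with $I$, such that $I$ is a stable set and the neighborhood of every vertex of $I$ is a clique of size at most $\eta$; \item for every $t\in V(T)$, the maximum degree of $R_t$ is at most $(d+1)\eta^2+d$. \end{enumerate}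
   Context: Graphs are finite and may have loops and parallel edges; degree counts loops twice. A tree-decomposition of $G$ is a pair $(T,(X_t:t\in V(T)))$ with $T$ a tree and $X_t\subseteq V(G)$ such that $\bigcup_t X_t=V(G)$, every edge of $G$ has all its ends in some $X_t$, and for every vertex $v$ the set $\{t: v\in X_t\}$ induces a connected subtree of $T$; its adhesion is $\max_{tt'\in E(T)}|X_t\cap X_{t'}|$, and its torso at $t$ is the graph obtained from $G[X_t]$ by, for each neighbor $t'$ of $t$, adding edges so that $X_t\cap X_{t'}$ becomes a clique. A tree-cut decomposition of $G$ is a pair $(T',(X'_t:t\in V(T')))$ where $T'$ is a tree and the $X'_t$ are pairwise disjoint, possibly empty, subsets of $V(G)$ with union $V(G)$. For a subtree $S$ write $X'_S=\bigcup_{t\in V(S)}X'_t$. The adhesion set of an edge $t_1t_2$ of $T'$ is the set of edges of $G$ with one end in $X'_{T_1}$ and the other in $X'_{T_2}$, where $T_1,T_2$ are the components of $T'-t_1t_2$; the adhesion is the maximum size of an adhesion set. The torso at $t$ in a tree-cut decomposition is obtained from $G$ by, for each edge $tt'$ of $T'$, identifying $X'_{T_{t,t'}}$ into a single vertex and deleting all loops at this new vertex, where $T_{t,t'}$ is the component of $T'-t$ containing $t'$. -}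

module Defs where

open import Data.Nat using (ℕ; zero; suc; _+_; _*_; _≤_; _<ᵇ_)
open import Data.Fin using (Fin; zero; suc; toℕ; _↑ˡ_; _↑ʳ_)
import Data.Fin as Fin
open import Data.Bool using (Bool; true; false; _∧_; _∨_; not; T)
open import Data.Product using (Σ; _×_; _,_; proj₁; proj₂; swap; map)
open import Data.Sum using (_⊎_; inj₁; inj₂)
open import Data.List using (List; length)
open import Data.List.Relation.Unary.All using (All)
open import Data.List.Relation.Unary.Unique.Propositional using (Unique)
open import Relation.Binary.PropositionalEquality using (_≡_; _≢_)
open import Relation.Nullary using (¬_)
open import Data.Empty using (⊥)
open import Data.Unit using (⊤)
open import Relation.Nullary.Decidable using (⌊_⌋)

-- Finite sets and counting (sets of a Fin-type are Bool-valued functions)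

_==_ : ∀ {k} → Fin k → Fin k → Bool
x == y = ⌊ x Fin.≟ y ⌋

anyF : ∀ {k} → (Fin k → Bool) → Bool
anyF {zero}  f = false
anyF {suc k} f = f zero ∨ anyF (λ i → f (suc i))

countF : ∀ {k} → (Fin k → Bool) → ℕ
countF {zero}  f = 0
countF {suc k} f = if' (f zero) + countF (λ i → f (suc i))
  where
  if' : Bool → ℕ
  if' true  = 1
  if' false = 0

AtMost : ℕ → {A : Set} → (A → Set) → Set
AtMost a {A} P = (L : List A) → Unique L → All P L → length L ≤ a

-- Reachability in a simple graph on Fin k given by a Bool adjacency
-- relation: reach adj s t = true iff t is reachable from s by a walk
-- whose steps u → w all satisfy adj u w  (breadth-first closure, k rounds).

iterate : {A : Set} → ℕ → (A → A) → A → A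
iterate zero    f a = a
iterate (suc i) f a = f (iterate i f a)

step : ∀ {k} → (Fin k → Fin k → Bool) → (Fin k → Bool) → Fin k → Bool
step adj S w = S w ∨ anyF (λ u → S u ∧ adj u w)

reach : ∀ {k} → (Fin k → Fin k → Bool) → Fin k → Fin k → Bool
reach {k} adj s = iterate k (step adj) (λ x → x == s)

withoutEdge : ∀ {k} → (Fin k → Fin k → Bool) → Fin k → Fin k → Fin k → Fin k → Bool
withoutEdge adj s t x y = adj x y ∧ not ((x == s ∧ y == t) ∨ (x == t ∧ y == s))

withoutVertex : ∀ {k} → (Fin k → Fin k → Bool) → Fin k → Fin k → Fin k → Bool
withoutVertex adj t x y = adj x y ∧ not (x == t) ∧ not (y == t)

induced : ∀ {k} → (Fin k → Fin k → Bool) → (Fin k → Bool) → Fin k → Fin k → Bool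
induced adj S x y = adj x y ∧ S x ∧ S y

-- Trees: a tree on vertex set Fin k is a nonempty simple graph (symmetric,
-- loopless Bool adjacency) that is connected and minimally connected
-- (every edge is a bridge, i.e. the graph is acyclic).

record IsTree {k : ℕ} (adj : Fin k → Fin k → Bool) : Set where
  field
    nonempty  : 1 ≤ k
    symmetric : ∀ s t → adj s t ≡ adj t s
    loopless  : ∀ t → adj t t ≡ false
    connected : ∀ s t → T (reach adj s t)
    acyclic   : ∀ s t → T (adj s t) → ¬ T (reach (withoutEdge adj s t) s t)

IsLeaf : ∀ {k} → (Fin k → Fin k → Bool) → Fin k → Set
IsLeaf adj t = countF (adj t) ≡ 1

-- Multigraphs (loops and parallel edges allowed).  An edge e has the
-- unordered pair of ends {proj₁ (ends e), proj₂ (ends e)}; a loop has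
-- equal ends.

record Graph : Set₁ where
  field
    V    : Set
    E    : Set
    ends : E → V × V

open Graph public

FinGraph : (n m : ℕ) → Set
FinGraph n m = Fin m → Fin n × Fin n

toGraph : ∀ {n m} → FinGraph n m → Graph
toGraph {n} {m} G = record { V = Fin n ; E = Fin m ; ends = G }

-- half-edges: (e , true) is the first end of e, (e , false) the second
end : (R : Graph) → E R × Bool → V R
end R (e , true)  = proj₁ (ends R e)
end R (e , false) = proj₂ (ends R e)

-- maximum degree at most D (degree = number of half-edges at v, so a loop
-- counts twice)
MaxDeg≤ : Graph → ℕ → Set
MaxDeg≤ R D = ∀ v → AtMost D (λ h → end R h ≡ v)

Adj : (R : Graph) → V R → V R → Set
Adj R x y = Σ (E R) λ e → (ends R e ≡ (x , y)) ⊎ (ends R e ≡ (y , x))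

Injective : {A B : Set} → (A → B) → Set
Injective f = ∀ x y → f x ≡ f y → x ≡ y

record _⊑_ (H R : Graph) : Set where
  field
    vmap     : V H → V R
    emap     : E H → E R
    vmap-inj : Injective vmap
    emap-inj : Injective emap
    ends-ok  : ∀ e → (ends R (emap e) ≡ map vmap vmap (ends H e))
                   ⊎ (ends R (emap e) ≡ swap (map vmap vmap (ends H e)))

-- Q is (isomorphic to) the graph obtained from H by identifying the vertex
-- set Z into a single vertex (edges are kept; edges inside Z become loops)
record Identification (H : Graph) (Z : V H → Set) (Q : Graph) : Set where
  field
    φ        : V H → V Q
    φ-surj   : ∀ q → Σ (V H) λ x → φ x ≡ q
    φ-fibres : ∀ x y → φ x ≡ φ y → (x ≡ y) ⊎ (Z x × Z y)
    φ-glue   : ∀ x y → Z x → Z y → φ x ≡ φ y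
    ψ        : E H → E Q
    ψ⁻       : E Q → E H
    ψ⁻ψ      : ∀ e → ψ⁻ (ψ e) ≡ e
    ψψ⁻      : ∀ e → ψ (ψ⁻ e) ≡ e
    ends-ψ   : ∀ e → ends Q (ψ e) ≡ map φ φ (ends H e)

addVertices : (Q : Graph) (I F : Set) → (F → (V Q ⊎ I) × (V Q ⊎ I)) → Graph
addVertices Q I F fe = record { V = V Q ⊎ I ; E = E Q ⊎ F ; ends = ends' }
  where
  ends' : E Q ⊎ F → (V Q ⊎ I) × (V Q ⊎ I)
  ends' (inj₁ e) = map inj₁ inj₁ (ends Q e)
  ends' (inj₂ f) = fe f

IsNew : {A I : Set} → A ⊎ I → Set
IsNew (inj₁ _) = ⊥
IsNew (inj₂ _) = ⊤

record RConstruction (η : ℕ) (Tor : Graph) : Set₁ where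
  field
    H       : Graph
    H⊑Tor   : H ⊑ Tor
    Z       : V H → Set
    Z-small : AtMost η Z
    Q       : Graph
    ident   : Identification H Z Q
    I       : Set
    F       : Set
    fe      : F → (V Q ⊎ I) × (V Q ⊎ I)
  R : Graph
  R = addVertices Q I F fe
  field
    F-incident : ∀ f → IsNew (proj₁ (fe f)) ⊎ IsNew (proj₂ (fe f))
    I-stable   : ∀ f → ¬ (IsNew (proj₁ (fe f)) × IsNew (proj₂ (fe f)))
    N-clique   : ∀ i x y → Adj R (inj₂ i) x → Adj R (inj₂ i) y → x ≢ y → Adj R x y
    N-small    : ∀ i → AtMost η (λ x → Adj R (inj₂ i) x)

module _ {n m k : ℕ} (G : FinGraph n m) (adj : Fin k → Fin k → Bool)
         (X : Fin k → Fin n → Bool) where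

  record IsTreeDecomposition : Set where
    field
      tree     : IsTree adj
      covers   : ∀ v → Σ (Fin k) λ t → T (X t v)
      edges    : ∀ e → Σ (Fin k) λ t → T (X t (proj₁ (G e))) × T (X t (proj₂ (G e)))
      coherent : ∀ v s t → T (X s v) → T (X t v) → T (reach (induced adj (λ u → X u v)) s t)

  TDAdhesion≤ : ℕ → Set
  TDAdhesion≤ a = ∀ s t → T (adj s t) → countF (λ v → X s v ∧ X t v) ≤ a

  -- torso at t: G[X_t] plus, for every pair u ≠ w of X_t lying together in
  -- some X_t ∩ X_t' (t' a neighbour of t) and not already adjacent in G,
  -- one new edge uw.
  module _ (t : Fin k) where
    private
      shared : Fin n → Fin n → Bool
      shared u w = anyF (λ t' → adj t t' ∧ X t' u ∧ X t' w)
      adjG : Fin n → Fin n → Bool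
      adjG u w = anyF (λ e → (proj₁ (G e) == u ∧ proj₂ (G e) == w)
                           ∨ (proj₁ (G e) == w ∧ proj₂ (G e) == u))
      TV : Set
      TV = Σ (Fin n) λ v → T (X t v)
      TE : Set
      TE = (Σ (Fin m) λ e → T (X t (proj₁ (G e))) × T (X t (proj₂ (G e))))
         ⊎ (Σ (Fin n × Fin n) λ p → T (X t (proj₁ p)) × T (X t (proj₂ p))
              × T (toℕ (proj₁ p) <ᵇ toℕ (proj₂ p)) × T (shared (proj₁ p) (proj₂ p))
              × T (not (adjG (proj₁ p) (proj₂ p))))
      ends' : TE → TV × TV
      ends' (inj₁ (e , p , q)) = (proj₁ (G e) , p) , (proj₂ (G e) , q)
      ends' (inj₂ ((u , w) , p , q , _)) = (u , p) , (w , q)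

    torsoTD : Graph
    torsoTD = record { V = TV ; E = TE ; ends = ends' }

-- Tree-cut decompositions (T' given by adj on Fin k; X'_t = {v | π v = t})

module _ {n m k : ℕ} (G : FinGraph n m) (adj : Fin k → Fin k → Bool)
         (π : Fin n → Fin k) where

  side : Fin k → Fin k → Fin k → Bool
  side t₁ t₂ x = reach (withoutEdge adj t₁ t₂) t₁ x

  adhesionSet : Fin k → Fin k → Fin m → Bool
  adhesionSet t₁ t₂ e =
      (side t₁ t₂ (π (proj₁ (G e))) ∧ side t₂ t₁ (π (proj₂ (G e))))
    ∨ (side t₂ t₁ (π (proj₁ (G e))) ∧ side t₁ t₂ (π (proj₂ (G e))))

  TCDAdhesion≤ : ℕ → Set
  TCDAdhesion≤ a = ∀ t₁ t₂ → T (adj t₁ t₂) → countF (adhesionSet t₁ t₂) ≤ a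

  -- torso at t: vertices X'_t plus one vertex for each neighbour t' of t
  -- (the identified set X'_{T_{t,t'}}); each edge of G becomes an edge
  -- between the representatives of its ends, except loops at new vertices,
  -- which are deleted.
  module _ (t : Fin k) where
    private
      branch : Fin k → Fin k → Bool
      branch t' x = reach (withoutVertex adj t) t' x
      TV : Set
      TV = (Σ (Fin n) λ v → T (π v == t)) ⊎ (Σ (Fin k) λ t' → T (adj t t'))
      represents : TV → Fin n → Bool
      represents (inj₁ (u , _))  v = u == v
      represents (inj₂ (t' , _)) v = branch t' (π v)
      newLoop : TV → TV → Bool
      newLoop (inj₂ (a , _)) (inj₂ (b , _)) = a == b
      newLoop _ _ = false
      TE : Set
      TE = Σ (Fin m) λ e → Σ (TV × TV) λ xy →
             T (represents (proj₁ xy) (proj₁ (G e)))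
           × T (represents (proj₂ xy) (proj₂ (G e)))
           × T (not (newLoop (proj₁ xy) (proj₂ xy)))
      ends' : TE → TV × TV
      ends' (_ , xy , _) = xy

    torsoTCD : Graph
    torsoTCD = record { V = TV ; E = TE ; ends = ends' }

-- T' (on Fin (k + l)) is obtained from T (on Fin k) by attaching leaves:
-- the nodes of T are the nodes s ↑ˡ l, T'[V(T)] = T, and every new node
-- k ↑ʳ j has exactly one neighbour in T', which is a node of T.
AttachLeaves : ∀ {k l} → (Fin k → Fin k → Bool) → (Fin (k + l) → Fin (k + l) → Bool) → Set
AttachLeaves {k} {l} adj adj' =
    (∀ s t → adj' (s ↑ˡ l) (t ↑ˡ l) ≡ adj s t)
  × (∀ j → Σ (Fin k) λ s → ∀ x → (T (adj' (k ↑ʳ j) x) → x ≡ s ↑ˡ l)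
                                 × (x ≡ s ↑ˡ l → T (adj' (k ↑ʳ j) x)))

module Submission where

-- Root T at a node r.  The home of a vertex v is the bag
-- containing v that is closest to r (first breadth-first layer meeting v).
-- T' is T with one new leaf for every vertex v, attached to home(v), and
-- X'_leaf(v) = {v}.
--
-- An edge of G crossing the tree edge st of T has an end in
-- X_s ∩ X_t (the walk between the homes of its ends leaves the s-side
-- inside the bags of that end), so at most d·η edges cross; a leaf edge is
-- crossed only by the ≤ d edges at its vertex.
--
-- At a node t with parent p and children c, the torso at t in T'
-- has one vertex for each vertex homed at t and one for each neighbour of t.
-- It embeds into R_t, obtained from the torso of (T, X) at t by keeping
-- only the edges needed (G-edges and virtual edges between two common
-- neighbours of a child), identifying Z = X_t ∩ X_p to a single vertex
-- (the image of the parent) and adding one new vertex per child c, adjacent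
-- to the ≤ η vertices of X_t ∩ X_c that send an edge into the c-side.
-- Degrees in R_t are bounded by counting half-edges through an injective
-- code into half-edges of G and pairs of common neighbours of children.

open import Defs
open import Data.Nat using (ℕ; zero; suc; _+_; _*_; _≤_; _<_; z≤n; s≤s; _<ᵇ_; >-nonZero)
open import Data.Nat.Properties
open import Data.Nat.Solver using (module +-*-Solver)
open import Data.Fin using (Fin; zero; suc; toℕ; _↑ˡ_; _↑ʳ_; splitAt)
import Data.Fin as Fin
import Data.Fin.Properties as FinP
open import Data.Fin.Properties using (splitAt-↑ˡ; splitAt-↑ʳ; splitAt⁻¹-↑ˡ; splitAt⁻¹-↑ʳ; ↑ˡ-injective; ↑ʳ-injective)
open import Data.Bool using (Bool; true; false; _∧_; _∨_; not; T)
open import Data.Bool.Properties using (T-irrelevant; T-∧; T-∨; not-injective)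
import Data.Product.Properties as Prod
open import Data.Product using (Σ; _×_; _,_; proj₁; proj₂; map; swap)
open import Data.Sum using (_⊎_; inj₁; inj₂; [_,_]′)
open import Data.Sum.Properties using (inj₁-injective; inj₂-injective)
open import Data.Empty using (⊥; ⊥-elim)
open import Data.Unit using (⊤; tt)
open import Data.List using (List; []; _∷_; length)
import Data.List as List
import Data.List.Properties as ListP
import Data.List.Relation.Unary.All as All
import Data.List.Relation.Unary.All.Properties as All
import Data.List.Relation.Unary.Unique.Propositional.Properties as Unique
open import Data.List.Relation.Unary.All using (All; []; _∷_)
open import Data.List.Relation.Unary.AllPairs using ([]; _∷_)
open import Data.List.Relation.Unary.Unique.Propositional using (Unique)
open import Function using (id)
open import Function.Bundles using (Equivalence)
open import Relation.Nullary using (¬_; Dec; yes; no)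
open import Relation.Nullary.Decidable using (toWitness; fromWitness; T?)
open import Relation.Binary using (tri<; tri≈; tri>)
open import Relation.Binary.PropositionalEquality using (_≡_; refl; sym; trans; cong; cong₂; subst; subst₂; _≢_)

T∧ : ∀ {a b} → T (a ∧ b) → T a × T b
T∧ {a} {b} = Equivalence.to (T-∧ {a} {b})

∧T : ∀ {a b} → T a → T b → T (a ∧ b)
∧T {a} {b} p q = Equivalence.from (T-∧ {a} {b}) (p , q)

T∨ : ∀ {a b} → T (a ∨ b) → T a ⊎ T b
T∨ {a} {b} = Equivalence.to (T-∨ {a} {b})

∨Tl : ∀ {a b} → T a → T (a ∨ b)
∨Tl {a} {b} p = Equivalence.from (T-∨ {a} {b}) (inj₁ p)

∨Tr : ∀ {a b} → T b → T (a ∨ b)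
∨Tr {a} {b} p = Equivalence.from (T-∨ {a} {b}) (inj₂ p)

Tnot : ∀ {a} → T (not a) → ¬ T a
Tnot {false} _ ()

notT : ∀ {a} → ¬ T a → T (not a)
notT {true} f = f tt
notT {false} _ = tt

decT : ∀ b → Dec (T b)
decT = T?

==→≡ : ∀ {k} {x y : Fin k} → T (x == y) → x ≡ y
==→≡ p = toWitness p

≡→== : ∀ {k} {x y : Fin k} → x ≡ y → T (x == y)
≡→== p = fromWitness p

==refl : ∀ {k} (x : Fin k) → T (x == x)
==refl x = ≡→== refl

≢→not== : ∀ {k} {x y : Fin k} → x ≢ y → ¬ T (x == y)
≢→not== ne p = ne (==→≡ p)

inj₁≢inj₂ : ∀ {A B : Set} {a : A} {b : B} → _≡_ {A = A ⊎ B} (inj₁ a) (inj₂ b) → ⊥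
inj₁≢inj₂ ()

Σ-irr : ∀ {A : Set} {B : A → Bool} {x y : A} {p : T (B x)} {q : T (B y)} → x ≡ y →
  _≡_ {A = Σ A (λ a → T (B a))} (x , p) (y , q)
Σ-irr {p = p} {q = q} refl = cong (_ ,_) (T-irrelevant p q)

anyF-elim : ∀ {k} (f : Fin k → Bool) → T (anyF f) → Σ (Fin k) λ i → T (f i)
anyF-elim {suc k} f p with T∨ {f zero} p
... | inj₁ q = zero , q
... | inj₂ q with anyF-elim (λ i → f (suc i)) q
...   | i , r = suc i , r

anyF-intro : ∀ {k} (f : Fin k → Bool) (i : Fin k) → T (f i) → T (anyF f)
anyF-intro {suc k} f zero p = ∨Tl {f zero} p
anyF-intro {suc k} f (suc i) p = ∨Tr {f zero} (anyF-intro (λ j → f (suc j)) i p)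

-- countF is monotone, bounded by k, and strictly grows when a new element
-- is added; these drive the termination of breadth-first search.

countF-≤ : ∀ {k} (f : Fin k → Bool) → countF f ≤ k
countF-≤ {zero} f = z≤n
countF-≤ {suc k} f with f zero
... | true = s≤s (countF-≤ (λ i → f (suc i)))
... | false = m≤n⇒m≤1+n (countF-≤ (λ i → f (suc i)))

countF-mono : ∀ {k} (f g : Fin k → Bool) → (∀ x → T (f x) → T (g x)) → countF f ≤ countF g
countF-mono {zero} f g h = z≤n
countF-mono {suc k} f g h with f zero | g zero | h zero
... | true | true | _ = s≤s (countF-mono (λ i → f (suc i)) (λ i → g (suc i)) (λ i → h (suc i)))
... | true | false | hz = ⊥-elim (hz tt)
... | false | true | _ = m≤n⇒m≤1+n (countF-mono (λ i → f (suc i)) (λ i → g (suc i)) (λ i → h (suc i)))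
... | false | false | _ = countF-mono (λ i → f (suc i)) (λ i → g (suc i)) (λ i → h (suc i))

countF-strict : ∀ {k} (f g : Fin k → Bool) → (∀ x → T (f x) → T (g x)) →
  (w : Fin k) → T (g w) → ¬ T (f w) → suc (countF f) ≤ countF g
countF-strict {suc k} f g h zero gw nfw with f zero | g zero | h zero
... | true | _ | _ = ⊥-elim (nfw tt)
... | false | true | _ = s≤s (countF-mono (λ i → f (suc i)) (λ i → g (suc i)) (λ i → h (suc i)))
... | false | false | _ = ⊥-elim gw
countF-strict {suc k} f g h (suc w) gw nfw with f zero | g zero | h zero
... | true | true | _ = s≤s (countF-strict (λ i → f (suc i)) (λ i → g (suc i)) (λ i → h (suc i)) w gw nfw)
... | true | false | hz = ⊥-elim (hz tt)
... | false | true | _ = m≤n⇒m≤1+n (countF-strict (λ i → f (suc i)) (λ i → g (suc i)) (λ i → h (suc i)) w gw nfw)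
... | false | false | _ = countF-strict (λ i → f (suc i)) (λ i → g (suc i)) (λ i → h (suc i)) w gw nfw

data Path {k} (adj : Fin k → Fin k → Bool) (s : Fin k) : Fin k → Set where
  here  : Path adj s s
  there : ∀ {u w} → Path adj s u → T (adj u w) → Path adj s w

Closed : ∀ {k} → (Fin k → Fin k → Bool) → (Fin k → Bool) → Set
Closed adj S = ∀ w → T (step adj S w) → T (S w)

step-mono : ∀ {k} (adj : Fin k → Fin k → Bool) (S S' : Fin k → Bool) →
  (∀ x → T (S x) → T (S' x)) → ∀ w → T (step adj S w) → T (step adj S' w)
step-mono adj S S' h w p with T∨ {S w} p
... | inj₁ q = ∨Tl {S' w} (h w q)
... | inj₂ q with anyF-elim _ q
...   | u , r with T∧ {S u} r
...     | a , b = ∨Tr {S' w} (anyF-intro _ u (∧T {S' u} (h u a) b))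

step-incl : ∀ {k} (adj : Fin k → Fin k → Bool) (S : Fin k → Bool) → ∀ w → T (S w) → T (step adj S w)
step-incl adj S w p = ∨Tl {S w} p

closedDec : ∀ {k} (adj : Fin k → Fin k → Bool) (S : Fin k → Bool) →
  Closed adj S ⊎ Σ (Fin k) λ w → T (step adj S w) × ¬ T (S w)
closedDec adj S with decT (anyF (λ w → step adj S w ∧ not (S w)))
... | yes p with anyF-elim _ p
...   | w , q with T∧ {step adj S w} q
...     | a , b = inj₂ (w , a , Tnot b)
closedDec adj S | no np = inj₁ λ w p → cl w p
  where
  cl : ∀ w → T (step adj S w) → T (S w)
  cl w p with decT (S w)
  ... | yes q = q
  ... | no nq = ⊥-elim (np (anyF-intro _ w (∧T {step adj S w} p (notT nq))))

-- reach adj s w holds iff there is a walk from s to w.  The i-th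
-- breadth-first layer either has more than i elements or is closed, so the
-- k-th layer is closed and contains every walk's end.
module _ {k : ℕ} (adj : Fin k → Fin k → Bool) (s : Fin k) where
  layer : ℕ → Fin k → Bool
  layer i = iterate i (step adj) (λ x → x == s)

  layer-suc : ∀ i w → T (layer i w) → T (layer (suc i) w)
  layer-suc i w p = step-incl adj (layer i) w p

  layer-mono : ∀ i j → i ≤ j → ∀ w → T (layer i w) → T (layer j w)
  layer-mono zero zero _ w p = p
  layer-mono zero (suc j) _ w p = layer-suc j w (layer-mono zero j z≤n w p)
  layer-mono (suc i) (suc j) (s≤s le) w p = step-mono adj (layer i) (layer j) (layer-mono i j le) w p

  layer-grows-or-closed : ∀ i → (suc i ≤ countF (layer i)) ⊎ Closed adj (layer i)
  layer-grows-or-closed zero =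
    inj₁ (≤-trans (s≤s z≤n) (countF-strict (λ _ → false) (layer zero) (λ _ ()) s (==refl s) λ ()))
  layer-grows-or-closed (suc i) with layer-grows-or-closed i | closedDec adj (layer i)
  ... | _ | inj₁ cl = inj₂ λ w p → layer-suc i w (cl w (step-mono adj (layer (suc i)) (layer i) cl w p))
  ... | inj₂ cl | inj₂ _ = inj₂ λ w p → layer-suc i w (cl w (step-mono adj (layer (suc i)) (layer i) cl w p))
  ... | inj₁ le | inj₂ (w , a , b) =
        inj₁ (≤-trans (s≤s le) (countF-strict (layer i) (layer (suc i)) (layer-suc i) w a b))

  last-layer-closed : Closed adj (layer k)
  last-layer-closed with layer-grows-or-closed k
  ... | inj₂ c = c
  ... | inj₁ le = ⊥-elim (<-irrefl refl (≤-trans le (countF-≤ (layer k))))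

  Path→reach : ∀ {w} → Path adj s w → T (reach adj s w)
  Path→reach here = layer-mono zero k z≤n s (==refl s)
  Path→reach (there {u} {w} p e) =
    last-layer-closed w (∨Tr {layer k w} (anyF-intro _ u (∧T {layer k u} (Path→reach p) e)))

  layer→Path : ∀ i w → T (layer i w) → Path adj s w
  layer→Path zero w p with ==→≡ {x = w} {y = s} p
  ... | refl = here
  layer→Path (suc i) w p with T∨ {layer i w} p
  ... | inj₁ q = layer→Path i w q
  ... | inj₂ q with anyF-elim _ q
  ...   | u , r with T∧ {layer i u} r
  ...     | a , b = there (layer→Path i u a) b

  reach→Path : ∀ {w} → T (reach adj s w) → Path adj s w
  reach→Path {w} p = layer→Path k w p

module _ {k : ℕ} where
  Adjk : Set
  Adjk = Fin k → Fin k → Bool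

  Path-++ : ∀ {a : Adjk} {s u w} → Path a s u → Path a u w → Path a s w
  Path-++ p here = p
  Path-++ p (there q e) = there (Path-++ p q) e

  Path-edge : ∀ {a : Adjk} {u w} → T (a u w) → Path a u w
  Path-edge e = there here e

  Path-rev : ∀ {a : Adjk} → (∀ x y → T (a x y) → T (a y x)) → ∀ {s w} → Path a s w → Path a w s
  Path-rev sy here = here
  Path-rev sy (there {u} {w} p e) = Path-++ (Path-edge (sy u w e)) (Path-rev sy p)

  Path-mono : ∀ {a b : Adjk} → (∀ x y → T (a x y) → T (b x y)) → ∀ {s w} → Path a s w → Path b s w
  Path-mono h here = here
  Path-mono h (there {u} {w} p e) = there (Path-mono h p) (h u w e)

  Path-last : ∀ {a : Adjk} {s w} → Path a s w → s ≢ w → Σ (Fin k) λ u → Path a s u × T (a u w)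
  Path-last here ne = ⊥-elim (ne refl)
  Path-last (there {u} p e) ne = u , p , e

  decPath : ∀ (a : Adjk) s w → Dec (Path a s w)
  decPath a s w with decT (reach a s w)
  ... | yes p = yes (reach→Path a s p)
  ... | no np = no λ p → np (Path→reach a s p)

  noE-intro : ∀ (a : Adjk) s t x y → T (a x y) → ¬ (x ≡ s × y ≡ t) → ¬ (x ≡ t × y ≡ s) →
    T (withoutEdge a s t x y)
  noE-intro a s t x y e n1 n2 = ∧T {a x y} e (notT λ h → excluded (T∨ {x == s ∧ y == t} h))
    where
    excluded : T (x == s ∧ y == t) ⊎ T (x == t ∧ y == s) → ⊥
    excluded (inj₁ q) with T∧ {x == s} q
    ... | q1 , q2 = n1 (==→≡ q1 , ==→≡ q2)
    excluded (inj₂ q) with T∧ {x == t} q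
    ... | q1 , q2 = n2 (==→≡ q1 , ==→≡ q2)

  noE-elim : ∀ (a : Adjk) s t x y → T (withoutEdge a s t x y) →
    T (a x y) × ¬ (x ≡ s × y ≡ t) × ¬ (x ≡ t × y ≡ s)
  noE-elim a s t x y h with T∧ {a x y} h
  ... | e , q = e , (λ { (refl , refl) → Tnot q (∨Tl {x == s ∧ y == t} (∧T {x == s} (==refl x) (==refl y))) })
                  , (λ { (refl , refl) → Tnot q (∨Tr {x == s ∧ y == t} (∧T {x == t} (==refl x) (==refl y))) })

  noV-intro : ∀ (a : Adjk) t x y → T (a x y) → x ≢ t → y ≢ t → T (withoutVertex a t x y)
  noV-intro a t x y e n1 n2 = ∧T {a x y} e (∧T {not (x == t)} (notT (≢→not== n1)) (notT (≢→not== n2)))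

  noV-elim : ∀ (a : Adjk) t x y → T (withoutVertex a t x y) → T (a x y) × x ≢ t × y ≢ t
  noV-elim a t x y h with T∧ {a x y} h
  ... | e , q with T∧ {not (x == t)} q
  ... | q1 , q2 = e , (λ eq → Tnot q1 (≡→== eq)) , (λ eq → Tnot q2 (≡→== eq))

  induced-elim : ∀ (a : Adjk) S x y → T (induced a S x y) → T (a x y) × T (S x) × T (S y)
  induced-elim a S x y h with T∧ {a x y} h
  ... | e , q with T∧ {S x} q
  ... | q1 , q2 = e , q1 , q2

  withoutEdge-sym : ∀ (a : Adjk) → (∀ x y → T (a x y) → T (a y x)) →
    ∀ s t x y → T (withoutEdge a s t x y) → T (withoutEdge a s t y x)
  withoutEdge-sym a sy s t x y h with noE-elim a s t x y h
  ... | e , n1 , n2 = noE-intro a s t y x (sy x y e) (λ { (p , q) → n2 (q , p) }) (λ { (p , q) → n1 (q , p) })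

  withoutVertex-sym : ∀ (a : Adjk) → (∀ x y → T (a x y) → T (a y x)) →
    ∀ t x y → T (withoutVertex a t x y) → T (withoutVertex a t y x)
  withoutVertex-sym a sy t x y h with noV-elim a t x y h
  ... | e , n1 , n2 = noV-intro a t y x (sy x y e) n2 n1

module TreeFacts {k : ℕ} (adj : Fin k → Fin k → Bool) (tr : IsTree adj) where
  open IsTree tr

  noE : Fin k → Fin k → Fin k → Fin k → Bool
  noE = withoutEdge adj

  noV : Fin k → Fin k → Fin k → Bool
  noV = withoutVertex adj

  adj-sym : ∀ x y → T (adj x y) → T (adj y x)
  adj-sym x y e = subst T (symmetric x y) e

  adj-ne : ∀ {x y} → T (adj x y) → x ≢ y
  adj-ne {x} e refl = subst T (loopless x) e

  noE-sym : ∀ s t x y → T (noE s t x y) → T (noE s t y x)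
  noE-sym = withoutEdge-sym adj adj-sym

  noE-swap : ∀ s t x y → T (noE s t x y) → T (noE t s x y)
  noE-swap s t x y h with noE-elim adj s t x y h
  ... | e , n1 , n2 = noE-intro adj t s x y e n2 n1

  noV-sym : ∀ t x y → T (noV t x y) → T (noV t y x)
  noV-sym = withoutVertex-sym adj adj-sym

  noV⊆noE : ∀ c t x y → T (noV t x y) → T (noE c t x y)
  noV⊆noE c t x y h with noV-elim adj t x y h
  ... | e , n1 , n2 = noE-intro adj c t x y e (λ { (_ , q) → n2 q }) (λ { (p , _) → n1 p })

  noV⊆noE' : ∀ t c x y → T (noV t x y) → T (noE t c x y)
  noV⊆noE' t c x y h = noE-swap c t x y (noV⊆noE c t x y h)

  Side : Fin k → Fin k → Fin k → Set
  Side a b x = Path (noE a b) a x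

  decSide : ∀ a b x → Dec (Side a b x)
  decSide a b x = decPath (noE a b) a x

  acyc : ∀ {a b} → T (adj a b) → ¬ Side a b b
  acyc {a} {b} e p = acyclic a b e (Path→reach (noE a b) a p)

  side-disj : ∀ {a b x} → T (adj a b) → Side a b x → Side b a x → ⊥
  side-disj {a} {b} e p q =
    acyc e (Path-++ p (Path-rev (noE-sym a b) (Path-mono (noE-swap b a) q)))

  leave : ∀ {a b x y} → T (adj a b) → Side a b x → T (adj x y) → ¬ Side a b y → (x ≡ a) × (y ≡ b)
  leave {a} {b} {x} {y} eab p exy ny with x Fin.≟ a | y Fin.≟ b
  ... | yes p1 | yes p2 = p1 , p2
  ... | no n1 | _ = ⊥-elim (ny (there p (noE-intro adj a b x y exy (λ { (q , _) → n1 q }) notBack)))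
    where
    notBack : ¬ (x ≡ b × y ≡ a)
    notBack (refl , _) = acyc eab p
  ... | yes _ | no n2 = ⊥-elim (ny (there p (noE-intro adj a b x y exy (λ { (_ , q) → n2 q }) notBack)))
    where
    notBack : ¬ (x ≡ b × y ≡ a)
    notBack (refl , _) = acyc eab p

  -- a walk inside S from the a-side of ab to outside it uses ab, so a, b ∈ S
  exit : ∀ {a b} (S : Fin k → Bool) {x y} → T (adj a b) → Path (induced adj S) x y →
    Side a b x → ¬ Side a b y → T (S a) × T (S b)
  exit S eab here sx ny = ⊥-elim (ny sx)
  exit {a} {b} S {x} eab (there {u} {y} p e) sx ny with induced-elim adj S u y e | decSide a b u
  ... | euy , su , sy | yes su' with leave eab su' euy ny
  ...   | refl , refl = su , sy
  exit S eab (there p e) sx ny | _ | no nu = exit S eab p sx nu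

  Br : Fin k → Fin k → Fin k → Set
  Br t c x = Path (noV t) c x

  Br-not-t : ∀ {t c} → Br t c t → c ≡ t
  Br-not-t {t} {c} p with c Fin.≟ t
  ... | yes q = q
  ... | no nq with Path-last p nq
  ...   | u , _ , e = ⊥-elim (proj₂ (proj₂ (noV-elim adj t u t e)) refl)

  branch-neighbour : ∀ {t c u} → T (adj t c) → Br t c u → T (adj u t) → u ≡ c
  branch-neighbour {t} {c} {u} etc p eut with u Fin.≟ c
  ... | yes q = q
  ... | no nq = ⊥-elim (acyc etc (Path-++ (Path-edge (noE-intro adj t c t u (adj-sym u t eut)
                  (λ { (_ , q) → nq q }) (λ { (q , _) → adj-ne etc q })))
                  (Path-mono (noV⊆noE' t c) (Path-rev (noV-sym t) p))))

  Side→Br : ∀ {c t y} → T (adj t c) → Side c t y → Br t c y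
  Side→Br etc here = here
  Side→Br {c} {t} etc (there {u} {y} p e) with Side→Br etc p | noE-elim adj c t u y e
  ... | bu | euy , n1 , n2 = there bu (noV-intro adj t u y euy ut yt)
    where
    ut : u ≢ t
    ut refl = adj-ne etc (sym (Br-not-t bu))
    yt : y ≢ t
    yt refl = n1 (branch-neighbour etc bu euy , refl)

  Br→Side : ∀ {c t y} → Br t c y → Side c t y
  Br→Side = Path-mono (noV⊆noE _ _)

  sides-disj : ∀ {t c1 c2 x} → T (adj t c1) → T (adj t c2) → c1 ≢ c2 → Side c1 t x → Side c2 t x → ⊥
  sides-disj {t} {c1} {c2} e1 e2 ne p q =
    acyc e1 (Path-++ (Path-edge (noE-intro adj t c1 t c2 e2 (λ { (_ , h) → ne (sym h) }) (λ { (h , _) → adj-ne e1 h })))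
      (Path-mono (noV⊆noE' t c1) (Path-++ (Side→Br e2 q) (Path-rev (noV-sym t) (Side→Br e1 p)))))

  t-not-side : ∀ {t c} → T (adj t c) → ¬ Side c t t
  t-not-side {t} {c} e = acyc (adj-sym t c e)

-- Images of walks under a map of vertex sets; Path-proj allows edges to
-- collapse to a single vertex.
Path-map : ∀ {k K} {a : Fin k → Fin k → Bool} {b : Fin K → Fin K → Bool} (f : Fin k → Fin K) →
  (∀ u w → T (a u w) → T (b (f u) (f w))) → ∀ {s x} → Path a s x → Path b (f s) (f x)
Path-map f h here = here
Path-map f h (there {u} {w} p e) = there (Path-map f h p) (h u w e)

Path-proj : ∀ {k K} {a : Fin K → Fin K → Bool} {b : Fin k → Fin k → Bool} (f : Fin K → Fin k) →
  (∀ u w → T (a u w) → (f u ≡ f w) ⊎ T (b (f u) (f w))) → ∀ {s x} → Path a s x → Path b (f s) (f x)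
Path-proj f h here = here
Path-proj f h (there {u} {w} p e) with h u w e
... | inj₁ eq = subst (Path _ _) eq (Path-proj f h p)
... | inj₂ e' = there (Path-proj f h p) e'

min-search-from : (g : ℕ → Bool) (N : ℕ) → T (g N) → ∀ m fuel → m + fuel ≡ N →
  (∀ j → j < m → ¬ T (g j)) → Σ ℕ λ i → T (g i) × (∀ j → j < i → ¬ T (g j))
min-search-from g N gN m fuel eq low with decT (g m)
... | yes gm = m , gm , low
min-search-from g N gN m zero eq low | no ngm rewrite +-identityʳ m | eq = ⊥-elim (ngm gN)
min-search-from g N gN m (suc fuel) eq low | no ngm =
  min-search-from g N gN (suc m) fuel (trans (sym (+-suc m fuel)) eq) low'
  where
  low' : ∀ j → j < suc m → ¬ T (g j)
  low' j (s≤s le) with <-cmp j m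
  ... | tri< a _ _ = low j a
  ... | tri≈ _ refl _ = ngm
  ... | tri> _ _ c = ⊥-elim (≤⇒≯ le c)

min-search : (g : ℕ → Bool) (N : ℕ) → T (g N) → Σ ℕ λ i → T (g i) × (∀ j → j < i → ¬ T (g j))
min-search g N gN = min-search-from g N gN 0 N refl (λ j ())

-- With T rooted at r, home v is a bag containing v in the
-- first breadth-first layer around r meeting v.  The essential property
-- (home-minimal): if c is a child of t (r is not on the c-side of tc) and
-- home v lies on the c-side, then v ∉ X_t, since t is in an earlier layer.
module HomeBags {k : ℕ} (adj : Fin k → Fin k → Bool) (tr : IsTree adj) (r : Fin k)
                {n : ℕ} (X : Fin k → Fin n → Bool) (cover : ∀ v → Σ (Fin k) λ t → T (X t v)) where
  open IsTree tr
  open TreeFacts adj tr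

  D : ℕ → Fin k → Bool
  D = layer adj r

  layer-enters-through : ∀ {t c} → T (adj t c) → ¬ Side c t r → ∀ i b → T (D i b) → Side c t b →
        Σ ℕ λ j → (suc j ≤ i) × T (D j t)
  layer-enters-through {t} {c} etc nr zero b db sb with ==→≡ {x = b} {y = r} db
  ... | refl = ⊥-elim (nr sb)
  layer-enters-through {t} {c} etc nr (suc i) b db sb with T∨ {D i b} db
  ... | inj₁ q with layer-enters-through etc nr i b q sb
  ...   | j , le , dj = j , m≤n⇒m≤1+n le , dj
  layer-enters-through {t} {c} etc nr (suc i) b db sb | inj₂ q with anyF-elim _ q
  ...   | a , h with T∧ {D i a} h
  ...     | da , eab with decSide c t a
  ...       | yes sa with layer-enters-through etc nr i a da sa
  ...         | j , le , dj = j , m≤n⇒m≤1+n le , dj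
  layer-enters-through {t} {c} etc nr (suc i) b db sb | inj₂ q | a , h | da , eab | no nsa
    with leave (adj-sym t c etc) sb (adj-sym a b eab) nsa
  ... | refl , refl = i , ≤-refl , da

  meets : Fin n → ℕ → Bool
  meets v i = anyF (λ b → D i b ∧ X b v)

  meets-last : ∀ v → T (meets v k)
  meets-last v = anyF-intro _ (proj₁ (cover v))
    (∧T {D k (proj₁ (cover v))} (connected r (proj₁ (cover v))) (proj₂ (cover v)))

  firstLayer : (v : Fin n) → Σ ℕ λ i → T (meets v i) × (∀ j → j < i → ¬ T (meets v j))
  firstLayer v = min-search (meets v) k (meets-last v)

  opaque
    homeWitness : (v : Fin n) → Σ (Fin k) λ b → T (D (proj₁ (firstLayer v)) b ∧ X b v)
    homeWitness v = anyF-elim _ (proj₁ (proj₂ (firstLayer v)))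

    home : Fin n → Fin k
    home v = proj₁ (homeWitness v)

    home-in : ∀ v → T (X (home v) v)
    home-in v = proj₂ (T∧ {D (proj₁ (firstLayer v)) (home v)} (proj₂ (homeWitness v)))

    home-minimal : ∀ {t c v} → T (adj t c) → ¬ Side c t r → Side c t (home v) → ¬ T (X t v)
    home-minimal {t} {c} {v} etc nr sh xt
      with layer-enters-through etc nr (proj₁ (firstLayer v)) (home v)
             (proj₁ (T∧ {D (proj₁ (firstLayer v)) (home v)} (proj₂ (homeWitness v)))) sh
    ... | j , le , dj = proj₂ (proj₂ (firstLayer v)) j le (anyF-intro _ t (∧T {D j t} dj xt))

module _ {A B : Set} {P : A → Set} where
  mapAll : (f : ∀ x → P x → B) → (L : List A) → All P L → List B
  mapAll f [] [] = []
  mapAll f (x ∷ L) (p ∷ ps) = f x p ∷ mapAll f L ps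

  mapAll-len : (f : ∀ x → P x → B) → (L : List A) → (ps : All P L) → length (mapAll f L ps) ≡ length L
  mapAll-len f [] [] = refl
  mapAll-len f (x ∷ L) (p ∷ ps) = cong suc (mapAll-len f L ps)

  mapAll-All : {Q : B → Set} (f : ∀ x → P x → B) → (∀ x p → Q (f x p)) → (L : List A) → (ps : All P L) →
    All Q (mapAll f L ps)
  mapAll-All f h [] [] = []
  mapAll-All f h (x ∷ L) (p ∷ ps) = h x p ∷ mapAll-All f h L ps

  mapAll-notin : (f : ∀ x → P x → B) → (∀ x y p q → f x p ≡ f y q → x ≡ y) →
    ∀ y q (L : List A) (ps : All P L) → All (y ≢_) L → All (f y q ≢_) (mapAll f L ps)
  mapAll-notin f inj y q [] [] [] = []
  mapAll-notin f inj y q (x ∷ L) (p ∷ ps) (ne ∷ nes) =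
    (λ eq → ne (inj y x q p eq)) ∷ mapAll-notin f inj y q L ps nes

  mapAll-Unique : (f : ∀ x → P x → B) → (∀ x y p q → f x p ≡ f y q → x ≡ y) →
    (L : List A) (ps : All P L) → Unique L → Unique (mapAll f L ps)
  mapAll-Unique f inj [] [] [] = []
  mapAll-Unique f inj (x ∷ L) (p ∷ ps) (h ∷ u) = mapAll-notin f inj x p L ps h ∷ mapAll-Unique f inj L ps u

AtMost-inj : ∀ {A B : Set} {P : A → Set} {Q : B → Set} {a} (f : ∀ x → P x → B) →
  (∀ x y p q → f x p ≡ f y q → x ≡ y) → (∀ x p → Q (f x p)) → AtMost a Q → AtMost a P
AtMost-inj {a = a} f inj hq am L u ps =
  subst (_≤ a) (mapAll-len f L ps) (am (mapAll f L ps) (mapAll-Unique f inj L ps u) (mapAll-All f hq L ps))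

AtMost-sub : ∀ {A : Set} {P Q : A → Set} {a} → (∀ x → P x → Q x) → AtMost a Q → AtMost a P
AtMost-sub {A} h = AtMost-inj (λ x _ → x) (λ x y _ _ eq → eq) h

AtMost-mono : ∀ {A : Set} {P : A → Set} {a b} → a ≤ b → AtMost a P → AtMost b P
AtMost-mono le am L u ps = ≤-trans (am L u ps) le

AtMost-empty : ∀ {A : Set} {P : A → Set} → (∀ x → ¬ P x) → AtMost 0 P
AtMost-empty h [] u ps = z≤n
AtMost-empty h (x ∷ L) u (p ∷ ps) = ⊥-elim (h x p)

AtMost-countF : ∀ {k} (f : Fin k → Bool) → AtMost (countF f) (λ x → T (f x))
AtMost-countF f [] u ps = z≤n
AtMost-countF f (x ∷ L) (h ∷ u) (p ∷ ps) =
  ≤-trans (s≤s (AtMost-countF (λ y → f y ∧ not (y == x)) L u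
            (All.map (λ {y} q → ∧T {f y} (proj₁ q) (notT (λ e → proj₂ q (sym (==→≡ e))))) (All.zip (ps , h)))))
          (countF-strict (λ y → f y ∧ not (y == x)) f (λ y q → proj₁ (T∧ {f y} q)) x p
            (λ q → Tnot (proj₂ (T∧ {f x} q)) (==refl x)))

enum : ∀ {k} (f : Fin k → Bool) → List (Fin k)
enum {zero} f = []
enum {suc k} f with f zero
... | true = zero ∷ List.map Fin.suc (enum (λ i → f (Fin.suc i)))
... | false = List.map Fin.suc (enum (λ i → f (Fin.suc i)))

enum-prop : ∀ {k} (f : Fin k → Bool) → Unique (enum f) × All (λ x → T (f x)) (enum f) × length (enum f) ≡ countF f
enum-prop {zero} f = [] , [] , refl
enum-prop {suc k} f with f zero in eq | enum-prop (λ i → f (Fin.suc i))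
... | true | u , a , l =
      (All.map⁺ (All.universal (λ _ ()) _) ∷ Unique.map⁺ FinP.suc-injective u) ,
      (subst T (sym eq) tt ∷ All.map⁺ a) ,
      cong suc (trans (ListP.length-map Fin.suc (enum (λ i → f (Fin.suc i)))) l)
... | false | u , a , l =
      Unique.map⁺ FinP.suc-injective u , All.map⁺ a ,
      trans (ListP.length-map Fin.suc (enum (λ i → f (Fin.suc i)))) l

countF-AtMost : ∀ {k} (f : Fin k → Bool) {a} → AtMost a (λ x → T (f x)) → countF f ≤ a
countF-AtMost f am with enum-prop f
... | u , a , l = subst (_≤ _) l (am (enum f) u a)

lefts : ∀ {A B : Set} → List (A ⊎ B) → List A
lefts [] = []
lefts (inj₁ x ∷ L) = x ∷ lefts L
lefts (inj₂ y ∷ L) = lefts L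

rights : ∀ {A B : Set} → List (A ⊎ B) → List B
rights [] = []
rights (inj₁ x ∷ L) = rights L
rights (inj₂ y ∷ L) = y ∷ rights L

module _ {A B : Set} where
  lr-len : (L : List (A ⊎ B)) → length L ≡ length (lefts L) + length (rights L)
  lr-len [] = refl
  lr-len (inj₁ x ∷ L) = cong suc (lr-len L)
  lr-len (inj₂ y ∷ L) = trans (cong suc (lr-len L)) (sym (+-suc (length (lefts L)) _))

  lefts-notin : ∀ x (L : List (A ⊎ B)) → All (inj₁ x ≢_) L → All (x ≢_) (lefts L)
  lefts-notin x [] [] = []
  lefts-notin x (inj₁ y ∷ L) (h ∷ hs) = (λ eq → h (cong inj₁ eq)) ∷ lefts-notin x L hs
  lefts-notin x (inj₂ y ∷ L) (h ∷ hs) = lefts-notin x L hs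

  rights-notin : ∀ x (L : List (A ⊎ B)) → All (inj₂ x ≢_) L → All (x ≢_) (rights L)
  rights-notin x [] [] = []
  rights-notin x (inj₁ y ∷ L) (h ∷ hs) = rights-notin x L hs
  rights-notin x (inj₂ y ∷ L) (h ∷ hs) = (λ eq → h (cong inj₂ eq)) ∷ rights-notin x L hs

  lefts-u : (L : List (A ⊎ B)) → Unique L → Unique (lefts L)
  lefts-u [] [] = []
  lefts-u (inj₁ x ∷ L) (h ∷ u) = lefts-notin x L h ∷ lefts-u L u
  lefts-u (inj₂ y ∷ L) (h ∷ u) = lefts-u L u

  rights-u : (L : List (A ⊎ B)) → Unique L → Unique (rights L)
  rights-u [] [] = []
  rights-u (inj₁ x ∷ L) (h ∷ u) = rights-u L u
  rights-u (inj₂ y ∷ L) (h ∷ u) = rights-notin y L h ∷ rights-u L u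

  lefts-All : {P : A ⊎ B → Set} (L : List (A ⊎ B)) → All P L → All (λ x → P (inj₁ x)) (lefts L)
  lefts-All [] [] = []
  lefts-All (inj₁ x ∷ L) (p ∷ ps) = p ∷ lefts-All L ps
  lefts-All (inj₂ y ∷ L) (p ∷ ps) = lefts-All L ps

  rights-All : {P : A ⊎ B → Set} (L : List (A ⊎ B)) → All P L → All (λ x → P (inj₂ x)) (rights L)
  rights-All [] [] = []
  rights-All (inj₁ x ∷ L) (p ∷ ps) = rights-All L ps
  rights-All (inj₂ y ∷ L) (p ∷ ps) = p ∷ rights-All L ps

  AtMost-⊎ : {P : A ⊎ B → Set} {a b : ℕ} → AtMost a (λ x → P (inj₁ x)) → AtMost b (λ y → P (inj₂ y)) →
    AtMost (a + b) P
  AtMost-⊎ am bm L u ps = subst (_≤ _) (sym (lr-len L))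
    (+-mono-≤ (am (lefts L) (lefts-u L u) (lefts-All L ps)) (bm (rights L) (rights-u L u) (rights-All L ps)))

AtMost-split : ∀ {A : Set} {P P1 P2 : A → Set} {a b} → (∀ x → P x → P1 x ⊎ P2 x) →
  AtMost a P1 → AtMost b P2 → AtMost (a + b) P
AtMost-split {A} {P} {P1} {P2} h am bm =
  AtMost-inj {Q = Q} f inj hq (AtMost-⊎ {P = Q} am bm)
  where
  Q : A ⊎ A → Set
  Q (inj₁ x) = P1 x
  Q (inj₂ x) = P2 x
  g : ∀ x → P1 x ⊎ P2 x → A ⊎ A
  g x (inj₁ _) = inj₁ x
  g x (inj₂ _) = inj₂ x
  f : ∀ x → P x → A ⊎ A
  f x p = g x (h x p)
  ginj : ∀ x y p q → g x p ≡ g y q → x ≡ y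
  ginj x y (inj₁ _) (inj₁ _) refl = refl
  ginj x y (inj₂ _) (inj₂ _) refl = refl
  inj : ∀ x y p q → f x p ≡ f y q → x ≡ y
  inj x y p q eq = ginj x y (h x p) (h y q) eq
  gq : ∀ x (p : P1 x ⊎ P2 x) → Q (g x p)
  gq x (inj₁ q) = q
  gq x (inj₂ q) = q
  hq : ∀ x p → Q (f x p)
  hq x p = gq x (h x p)

countF-∨ : ∀ {k} (f g : Fin k → Bool) → countF (λ x → f x ∨ g x) ≤ countF f + countF g
countF-∨ {zero} f g = z≤n
countF-∨ {suc k} f g with f zero | g zero | countF-∨ (λ i → f (suc i)) (λ i → g (suc i))
... | true | true | ih = s≤s (≤-trans (m≤n⇒m≤1+n ih) (≤-reflexive (sym (+-suc _ _))))
... | true | false | ih = s≤s ih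
... | false | true | ih = ≤-trans (s≤s ih) (≤-reflexive (sym (+-suc _ _)))
... | false | false | ih = ih

countF-false : ∀ {k} (f : Fin k → Bool) → (∀ x → ¬ T (f x)) → countF f ≡ 0
countF-false {zero} f h = refl
countF-false {suc k} f h with f zero | h zero
... | true | hz = ⊥-elim (hz tt)
... | false | _ = countF-false (λ i → f (suc i)) (λ i → h (suc i))

countF-anyF : ∀ {k k'} (P : Fin k' → Bool) (Q : Fin k' → Fin k → Bool) (B : ℕ) →
  (∀ c → T (P c) → countF (Q c) ≤ B) →
  countF (λ w → anyF (λ c → P c ∧ Q c w)) ≤ countF P * B
countF-anyF {k} {zero} P Q B h = ≤-reflexive (countF-false {k} (λ w → false) (λ _ ()))
countF-anyF {k} {suc k'} P Q B h with P zero in eq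
... | true = ≤-trans (countF-∨ (λ w → Q zero w) _)
               (+-mono-≤ (h zero (subst T (sym eq) tt))
                 (countF-anyF (λ c → P (suc c)) (λ c → Q (suc c)) B (λ c → h (suc c))))
... | false = countF-anyF (λ c → P (suc c)) (λ c → Q (suc c)) B (λ c → h (suc c))

AtMost-bySet : ∀ {n} {Hh : Set} (endf : Hh → Fin n) (P : Hh → Set) (M : ℕ) (B : Fin n → Bool) →
  (∀ a → T (B a) → AtMost M (λ h → endf h ≡ a × P h)) →
  AtMost (countF B * M) (λ h → T (B (endf h)) × P h)
AtMost-bySet {n} {Hh} endf P M B0 hyp = aux (countF B0) B0 ≤-refl hyp
  where
  aux : ∀ N (B : Fin n → Bool) → countF B ≤ N → (∀ a → T (B a) → AtMost M (λ h → endf h ≡ a × P h)) →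
    AtMost (countF B * M) (λ h → T (B (endf h)) × P h)
  aux N B le h with decT (anyF B)
  ... | no nb = AtMost-mono z≤n (AtMost-empty (λ x p → nb (anyF-intro B (endf x) (proj₁ p))))
  ... | yes q with anyF-elim B q
  ... | a , ba = AtMost-mono bound (AtMost-split split (h a ba) rec)
    where
    B' : Fin n → Bool
    B' x = B x ∧ not (x == a)
    strict : suc (countF B') ≤ countF B
    strict = countF-strict B' B (λ x p → proj₁ (T∧ {B x} p)) a ba (λ p → Tnot (proj₂ (T∧ {B a} p)) (==refl a))
    rec' : ∀ N0 → countF B ≤ N0 → AtMost (countF B' * M) (λ h → T (B' (endf h)) × P h)
    rec' zero le0 = ⊥-elim (≤⇒≯ (≤-trans strict le0) (s≤s z≤n))
    rec' (suc N') le0 = aux N' B' (≤-pred (≤-trans strict le0)) (λ x p → h x (proj₁ (T∧ {B x} p)))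
    rec : AtMost (countF B' * M) (λ h → T (B' (endf h)) × P h)
    rec = rec' N le
    split : ∀ x → T (B (endf x)) × P x → (endf x ≡ a × P x) ⊎ (T (B' (endf x)) × P x)
    split x (bx , px) = split' (decT (endf x == a))
      where
      split' : Dec (T (endf x == a)) → (endf x ≡ a × P x) ⊎ (T (B' (endf x)) × P x)
      split' (yes e) = inj₁ (==→≡ e , px)
      split' (no ne) = inj₂ (∧T {B (endf x)} bx (notT ne) , px)
    bound : M + countF B' * M ≤ countF B * M
    bound = *-monoˡ-≤ M strict

AtMost1 : ∀ {A : Set} {P : A → Set} → (∀ x y → P x → P y → x ≡ y) → AtMost 1 P
AtMost1 h [] u ps = z≤n
AtMost1 h (x ∷ []) u ps = s≤s z≤n
AtMost1 h (x ∷ y ∷ L) ((ne ∷ _) ∷ _) (px ∷ py ∷ _) = ⊥-elim (ne (h x y px py))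

countF-single : ∀ {k} (f : Fin k → Bool) (a : Fin k) → (∀ x → T (f x) → x ≡ a) → T (f a) → countF f ≡ 1
countF-single {k} f a h fa = Data.Nat.Properties.≤-antisym
  (countF-AtMost f (AtMost1 (λ x y px py → trans (h x px) (sym (h y py)))))
  (subst (_≤ countF f) (cong suc (countF-false {k} (λ _ → false) (λ _ ())))
    (countF-strict (λ _ → false) f (λ _ ()) a fa (λ ())))

-- Projecting new
-- nodes to their attachment point (P) maps walks of T' - (edge or vertex)
-- to walks of T - (same), which gives acyclicity of T' and describes its
-- sides and branches in terms of those of T.
module LeafExtension {k n : ℕ} (adj : Fin k → Fin k → Bool) (tr : IsTree adj) (home : Fin n → Fin k) where
  open IsTree tr
  open TreeFacts adj tr

  adjS : Fin k ⊎ Fin n → Fin k ⊎ Fin n → Bool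
  adjS (inj₁ s) (inj₁ t) = adj s t
  adjS (inj₁ s) (inj₂ j) = home j == s
  adjS (inj₂ j) (inj₁ s) = home j == s
  adjS (inj₂ _) (inj₂ _) = false

  adj' : Fin (k + n) → Fin (k + n) → Bool
  adj' x y = adjS (splitAt k x) (splitAt k y)

  P : Fin (k + n) → Fin k
  P x = [ id , home ]′ (splitAt k x)

  old : Fin k → Fin (k + n)
  old s = s ↑ˡ n

  new : Fin n → Fin (k + n)
  new j = k ↑ʳ j

  data View : Fin (k + n) → Set where
    vo : (s : Fin k) → View (old s)
    vn : (j : Fin n) → View (new j)

  view : ∀ x → View x
  view x with splitAt k x in eq
  ... | inj₁ s = subst View (splitAt⁻¹-↑ˡ eq) (vo s)
  ... | inj₂ j = subst View (splitAt⁻¹-↑ʳ eq) (vn j)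

  sp-old : ∀ s → splitAt k (old s) ≡ inj₁ s
  sp-old s = splitAt-↑ˡ k s n

  sp-new : ∀ j → splitAt k (new j) ≡ inj₂ j
  sp-new j = splitAt-↑ʳ k n j

  old≢new : ∀ {s j} → old s ≢ new j
  old≢new {s} {j} eq with trans (sym (sp-old s)) (trans (cong (splitAt k) eq) (sp-new j))
  ... | ()

  old-inj : ∀ {s t} → old s ≡ old t → s ≡ t
  old-inj {s} {t} = ↑ˡ-injective n s t

  new-inj : ∀ {i j} → new i ≡ new j → i ≡ j
  new-inj {i} {j} = ↑ʳ-injective k i j

  adj'-oo : ∀ s t → adj' (old s) (old t) ≡ adj s t
  adj'-oo s t rewrite sp-old s | sp-old t = refl

  adj'-on : ∀ s j → adj' (old s) (new j) ≡ (home j == s)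
  adj'-on s j rewrite sp-old s | sp-new j = refl

  adj'-no : ∀ j s → adj' (new j) (old s) ≡ (home j == s)
  adj'-no j s rewrite sp-old s | sp-new j = refl

  adj'-nn : ∀ i j → adj' (new i) (new j) ≡ false
  adj'-nn i j rewrite sp-new i | sp-new j = refl

  P-old : ∀ s → P (old s) ≡ s
  P-old s rewrite sp-old s = refl

  P-new : ∀ j → P (new j) ≡ home j
  P-new j rewrite sp-new j = refl

  adjS-sym : ∀ a b → adjS a b ≡ adjS b a
  adjS-sym (inj₁ s) (inj₁ t) = symmetric s t
  adjS-sym (inj₁ s) (inj₂ j) = refl
  adjS-sym (inj₂ j) (inj₁ s) = refl
  adjS-sym (inj₂ _) (inj₂ _) = refl

  adjS-loop : ∀ a → adjS a a ≡ false
  adjS-loop (inj₁ s) = loopless s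
  adjS-loop (inj₂ j) = refl

  adj'-sym : ∀ x y → T (adj' x y) → T (adj' y x)
  adj'-sym x y e = subst T (adjS-sym (splitAt k x) (splitAt k y)) e

  EdgeK : Fin (k + n) → Fin (k + n) → Set
  EdgeK x y = (Σ (Fin k) λ s → Σ (Fin k) λ t → x ≡ old s × y ≡ old t × T (adj s t))
            ⊎ (Σ (Fin n) λ j → x ≡ old (home j) × y ≡ new j)
            ⊎ (Σ (Fin n) λ j → x ≡ new j × y ≡ old (home j))

  edgeK : ∀ x y → T (adj' x y) → EdgeK x y
  edgeK x y e with view x | view y
  ... | vo s | vo t = inj₁ (s , t , refl , refl , subst T (adj'-oo s t) e)
  ... | vo s | vn j with ==→≡ {x = home j} {y = s} (subst T (adj'-on s j) e)
  ...   | refl = inj₂ (inj₁ (j , refl , refl))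
  edgeK x y e | vn j | vo s with ==→≡ {x = home j} {y = s} (subst T (adj'-no j s) e)
  ...   | refl = inj₂ (inj₂ (j , refl , refl))
  edgeK x y e | vn i | vn j = ⊥-elim (subst T (adj'-nn i j) e)

  e-no : ∀ j → T (adj' (new j) (old (home j)))
  e-no j = subst T (sym (adj'-no j (home j))) (==refl (home j))

  e-oo : ∀ s t → T (adj s t) → T (adj' (old s) (old t))
  e-oo s t e = subst T (sym (adj'-oo s t)) e

  into-new : ∀ u j → T (adj' u (new j)) → u ≡ old (home j)
  into-new u j e with edgeK u (new j) e
  ... | inj₁ (s , t , _ , eq , _) = ⊥-elim (old≢new (sym eq))
  ... | inj₂ (inj₁ (i , refl , eq)) = cong (λ z → old (home z)) (sym (new-inj eq))
  ... | inj₂ (inj₂ (i , _ , eq)) = ⊥-elim (old≢new (sym eq))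

  K : ℕ
  K = k + n

  noE' : Fin K → Fin K → Fin K → Fin K → Bool
  noE' = withoutEdge adj'

  noV' : Fin K → Fin K → Fin K → Bool
  noV' = withoutVertex adj'

  -- connectivity: go to the attachment point and follow T
  to-old : ∀ x → Path adj' x (old (P x))
  to-old x with view x
  ... | vo s rewrite P-old s = here
  ... | vn j rewrite P-new j = Path-edge (e-no j)

  lift : ∀ {s t} → Path adj s t → Path adj' (old s) (old t)
  lift = Path-map old e-oo

  connected' : ∀ x y → Path adj' x y
  connected' x y = Path-++ (to-old x) (Path-++ (lift (reach→Path adj (P x) (connected (P x) (P y))))
                     (Path-rev adj'-sym (to-old y)))

  last-into-new : ∀ {A : Fin K → Fin K → Bool} → (∀ u w → T (A u w) → T (adj' u w)) →
    ∀ {z j} → Path A z (new j) → z ≢ new j → T (A (old (home j)) (new j))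
  last-into-new sub {z} {j} p ne with Path-last p ne
  ... | u , _ , e with into-new u j (sub u (new j) e)
  ...   | refl = e

  noE'⊆adj' : ∀ a b u w → T (noE' a b u w) → T (adj' u w)
  noE'⊆adj' a b u w h = proj₁ (noE-elim adj' a b u w h)

  -- acyclicity: a cycle through an old edge projects to one in T, and a
  -- walk avoiding a leaf edge cannot reach the leaf
  noE'-proj : ∀ s t u w → T (noE' (old s) (old t) u w) → (P u ≡ P w) ⊎ T (noE s t (P u) (P w))
  noE'-proj s t u w h with noE-elim adj' (old s) (old t) u w h
  ... | e , n1 , n2 with edgeK u w e
  ... | inj₁ (a , b , refl , refl , eab) rewrite P-old a | P-old b =
        inj₂ (noE-intro adj s t a b eab (λ { (refl , refl) → n1 (refl , refl) }) (λ { (refl , refl) → n2 (refl , refl) }))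
  ... | inj₂ (inj₁ (j , refl , refl)) rewrite P-old (home j) | P-new j = inj₁ refl
  ... | inj₂ (inj₂ (j , refl , refl)) rewrite P-old (home j) | P-new j = inj₁ refl

  noV'-proj : ∀ t u w → T (noV' (old t) u w) → (P u ≡ P w) ⊎ T (noV t (P u) (P w))
  noV'-proj t u w h with noV-elim adj' (old t) u w h
  ... | e , n1 , n2 with edgeK u w e
  ... | inj₁ (a , b , refl , refl , eab) rewrite P-old a | P-old b =
        inj₂ (noV-intro adj t a b eab (λ { refl → n1 refl }) (λ { refl → n2 refl }))
  ... | inj₂ (inj₁ (j , refl , refl)) rewrite P-old (home j) | P-new j = inj₁ refl
  ... | inj₂ (inj₂ (j , refl , refl)) rewrite P-old (home j) | P-new j = inj₁ refl

  side-proj : ∀ {s t x} → Path (noE' (old s) (old t)) (old s) x → Side s t (P x)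
  side-proj {s} {t} p = subst (λ z → Path (noE s t) z _) (P-old s) (Path-proj P (noE'-proj s t) p)

  br-proj : ∀ {t c x} → Path (noV' (old t)) (old c) x → Br t c (P x)
  br-proj {t} {c} p = subst (λ z → Path (noV t) z _) (P-old c) (Path-proj P (noV'-proj t) p)

  acyclic' : ∀ a b → T (adj' a b) → ¬ T (reach (noE' a b) a b)
  acyclic' a b e r with reach→Path (noE' a b) a r | edgeK a b e
  ... | p | inj₁ (s , t , refl , refl , est) = acyc est (subst (Side s t) (P-old t) (side-proj p))
  ... | p | inj₂ (inj₁ (j , refl , refl)) =
        proj₁ (proj₂ (noE-elim adj' _ _ _ _ (last-into-new (noE'⊆adj' _ _) p old≢new))) (refl , refl)
  ... | p | inj₂ (inj₂ (j , refl , refl)) =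
        proj₂ (proj₂ (noE-elim adj' _ _ _ _
          (last-into-new (noE'⊆adj' _ _) (Path-rev (withoutEdge-sym adj' adj'-sym _ _) p) old≢new))) (refl , refl)

  nonempty' : 1 ≤ K
  nonempty' = ≤-trans nonempty (m≤m+n k n)

  tree' : IsTree adj'
  tree' = record
    { nonempty = nonempty'
    ; symmetric = λ x y → adjS-sym (splitAt k x) (splitAt k y)
    ; loopless = λ x → adjS-loop (splitAt k x)
    ; connected = λ x y → Path→reach adj' x (connected' x y)
    ; acyclic = acyclic'
    }

  leaf-side : ∀ {a b j x} → ((a ≡ new j × b ≡ old (home j)) ⊎ (a ≡ old (home j) × b ≡ new j)) →
    Path (noE' a b) (new j) x → x ≡ new j
  leaf-side {a} {b} {j} {x} ab p with x Fin.≟ new j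
  ... | yes q = q
  ... | no nq with noE-elim adj' a b _ _ (last-into-new (noE'⊆adj' a b)
                     (Path-rev (withoutEdge-sym adj' adj'-sym a b) p) nq)
  ... | _ , n1 , n2 with ab
  ...   | inj₁ (refl , refl) = ⊥-elim (n2 (refl , refl))
  ...   | inj₂ (refl , refl) = ⊥-elim (n1 (refl , refl))

  leaf-branch : ∀ {t j x} → home j ≡ t → Path (noV' (old t)) (new j) x → x ≡ new j
  leaf-branch {t} {j} {x} refl p with x Fin.≟ new j
  ... | yes q = q
  ... | no nq with noV-elim adj' (old t) _ _ (last-into-new (λ u w h → proj₁ (noV-elim adj' (old t) u w h))
                     (Path-rev (withoutVertex-sym adj' adj'-sym (old t)) p) nq)
  ... | _ , n1 , _ = ⊥-elim (n1 refl)

  attach : AttachLeaves adj adj'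
  attach = adj'-oo , λ j → home j , λ x → f j x , g j x
    where
    f : ∀ j x → T (adj' (k ↑ʳ j) x) → x ≡ home j ↑ˡ n
    f j x e with edgeK (new j) x e
    ... | inj₁ (s , t , eq , _) = ⊥-elim (old≢new (sym eq))
    ... | inj₂ (inj₁ (i , eq , _)) = ⊥-elim (old≢new (sym eq))
    ... | inj₂ (inj₂ (i , eq , refl)) = cong (λ z → old (home z)) (sym (new-inj eq))
    g : ∀ j x → x ≡ home j ↑ˡ n → T (adj' (k ↑ʳ j) x)
    g j x refl = e-no j

  leaf-isLeaf : ∀ j → IsLeaf adj' (new j)
  leaf-isLeaf j = countF-single (adj' (new j)) (old (home j)) (λ x e → proj₁ (proj₂ attach j .proj₂ x) e) (e-no j)

module EdgeCounting {n m d : ℕ} (G : FinGraph n m) (maxdeg : MaxDeg≤ (toGraph G) d) where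
  e1 e2 : Fin m → Fin n
  e1 e = proj₁ (G e)
  e2 e = proj₂ (G e)

  atV : Fin n → Fin m → Bool
  atV a e = (e1 e == a) ∨ (e2 e == a)

  hsel : ∀ a e → T (atV a e) → Fin m × Bool
  hsel a e _ = e , (e1 e == a)

  hsel-ok : ∀ a e p → end (toGraph G) (hsel a e p) ≡ a
  hsel-ok a e p with e1 e == a in eq
  ... | true = ==→≡ (subst T (sym eq) tt)
  ... | false = ==→≡ p

  deg-edges : ∀ a → countF (atV a) ≤ d
  deg-edges a = countF-AtMost (atV a)
    (AtMost-inj (hsel a) (λ x y p q eq → cong proj₁ eq) (hsel-ok a) (maxdeg a))

  set-edges : (A : Fin n → Bool) → countF (λ e → A (e1 e) ∨ A (e2 e)) ≤ countF A * d
  set-edges A = ≤-trans (countF-mono _ _ h) (countF-anyF A atV d (λ a _ → deg-edges a))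
    where
    h : ∀ e → T (A (e1 e) ∨ A (e2 e)) → T (anyF (λ a → A a ∧ atV a e))
    h e p with T∨ {A (e1 e)} p
    ... | inj₁ q = anyF-intro _ (e1 e) (∧T {A (e1 e)} q (∨Tl {e1 e == e1 e} (==refl (e1 e))))
    ... | inj₂ q = anyF-intro _ (e2 e) (∧T {A (e2 e)} q (∨Tr {e1 e == e2 e} (==refl (e2 e))))

module Construction (d η : ℕ) {n m : ℕ} (G : FinGraph n m) (maxdeg : MaxDeg≤ (toGraph G) d)
             {k : ℕ} (adj : Fin k → Fin k → Bool) (X : Fin k → Fin n → Bool)
             (td : IsTreeDecomposition G adj X) (adh : TDAdhesion≤ G adj X η) (r : Fin k) where
  open IsTreeDecomposition td
  open EdgeCounting G maxdeg public
  open TreeFacts adj tree public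
  open HomeBags adj tree r X covers public
  open LeafExtension adj tree home public

  π : Fin n → Fin (k + n)
  π v = new v

  walk : ∀ v {s t} → T (X s v) → T (X t v) → Path (induced adj (λ u → X u v)) s t
  walk v {s} {t} p q = reach→Path _ s (coherent v s t p q)

  crossing : ∀ {s t} e → T (adj s t) → Side s t (home (e1 e)) → Side t s (home (e2 e)) →
    T (X s (e1 e) ∧ X t (e1 e)) ⊎ T (X s (e2 e) ∧ X t (e2 e))
  crossing {s} {t} e est su sw with edges e
  ... | b , xu , xw with decSide s t b
  ... | yes sb =
        let z = exit (λ u → X u (e2 e)) est (walk (e2 e) xw (home-in (e2 e))) sb (λ q → side-disj est q sw)
        in inj₂ (∧T {X s (e2 e)} (proj₁ z) (proj₂ z))
  ... | no nb =
        let z = exit (λ u → X u (e1 e)) est (walk (e1 e) (home-in (e1 e)) xu) su nb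
        in inj₁ (∧T {X s (e1 e)} (proj₁ z) (proj₂ z))

  dη≤bound : d * η ≤ (d + 1) * (d + 1) * η + d
  dη≤bound = ≤-trans (*-monoˡ-≤ η (≤-trans (m≤m+n d 1) (m≤m*n (d + 1) (d + 1) {{>-nonZero (m≤n+m 1 d)}})))
                 (m≤m+n ((d + 1) * (d + 1) * η) d)

  side' : Fin (k + n) → Fin (k + n) → Fin (k + n) → Bool
  side' = side G adj' π

  LeafEdge : Fin n → Fin (k + n) → Fin (k + n) → Set
  LeafEdge j a b = (a ≡ new j × b ≡ old (home j)) ⊎ (a ≡ old (home j) × b ≡ new j)

  -- only edges at j cross the leaf edge of j
  leafcase : ∀ j {a b} → LeafEdge j a b →
    countF (adhesionSet G adj' π a b) ≤ (d + 1) * (d + 1) * η + d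
  leafcase j {a} {b} ab = ≤-trans (countF-mono _ (atV j) h) (≤-trans (deg-edges j) (m≤n+m d _))
    where
    lj : ∀ {a' b' x} → LeafEdge j a' b' →
         T (side' a' b' x) → a' ≡ new j → x ≡ new j
    lj {a'} {b'} ab' p refl = leaf-side ab' (reach→Path (noE' a' b') (new j) p)
    swap' : ∀ {a' b'} → LeafEdge j a' b' → LeafEdge j b' a'
    swap' (inj₁ (p , q)) = inj₂ (q , p)
    swap' (inj₂ (p , q)) = inj₁ (q , p)
    atj : ∀ e → (e1 e ≡ j) ⊎ (e2 e ≡ j) → T (atV j e)
    atj e (inj₁ eq) = ∨Tl {e1 e == j} (≡→== eq)
    atj e (inj₂ eq) = ∨Tr {e1 e == j} (≡→== eq)
    h : ∀ e → T (adhesionSet G adj' π a b e) → T (atV j e)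
    h e p = atj e (lem ab)
      where
      lem : LeafEdge j a b → (e1 e ≡ j) ⊎ (e2 e ≡ j)
      lem (inj₁ (refl , refl)) with T∨ {side' a b (π (e1 e)) ∧ side' b a (π (e2 e))} p
      ... | inj₁ q = inj₁ (new-inj (lj ab (proj₁ (T∧ {side' a b (π (e1 e))} q)) refl))
      ... | inj₂ q = inj₂ (new-inj (lj ab (proj₂ (T∧ {side' b a (π (e1 e))} q)) refl))
      lem (inj₂ (refl , refl)) with T∨ {side' a b (π (e1 e)) ∧ side' b a (π (e2 e))} p
      ... | inj₁ q = inj₂ (new-inj (lj (swap' ab) (proj₂ (T∧ {side' a b (π (e1 e))} q)) refl))
      ... | inj₂ q = inj₁ (new-inj (lj (swap' ab) (proj₁ (T∧ {side' b a (π (e1 e))} q)) refl))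

  -- a tree edge st is crossed only by edges meeting X_s ∩ X_t (≤ d·η of
  -- them), a leaf edge only by the ≤ d edges at its vertex
  adhesion : TCDAdhesion≤ G adj' π ((d + 1) * (d + 1) * η + d)
  adhesion t1 t2 e12 with edgeK t1 t2 e12
  ... | inj₁ (s , t , refl , refl , est) =
        ≤-trans (countF-mono _ (λ e → A (e1 e) ∨ A (e2 e)) h)
          (≤-trans (set-edges A) (≤-trans (*-monoˡ-≤ d (adh s t est))
            (subst (_≤ (d + 1) * (d + 1) * η + d) (*-comm d η) dη≤bound)))
    where
    A : Fin n → Bool
    A v = X s v ∧ X t v
    sd : ∀ {a b x} → T (side' a b x) → Path (noE' a b) a x
    sd {a} {b} p = reach→Path (noE' a b) a p
    cr1 : ∀ e → Side s t (home (e1 e)) → Side t s (home (e2 e)) → T (A (e1 e) ∨ A (e2 e))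
    cr1 e p q with crossing e est p q
    ... | inj₁ z = ∨Tl {A (e1 e)} z
    ... | inj₂ z = ∨Tr {A (e1 e)} z
    cr2 : ∀ e → Side t s (home (e1 e)) → Side s t (home (e2 e)) → T (A (e1 e) ∨ A (e2 e))
    cr2 e p q with crossing e (adj-sym s t est) p q
    ... | inj₁ z = ∨Tl {A (e1 e)} (∧T {X s (e1 e)} (proj₂ (T∧ {X t (e1 e)} z)) (proj₁ (T∧ {X t (e1 e)} z)))
    ... | inj₂ z = ∨Tr {A (e1 e)} (∧T {X s (e2 e)} (proj₂ (T∧ {X t (e2 e)} z)) (proj₁ (T∧ {X t (e2 e)} z)))
    h : ∀ e → T (adhesionSet G adj' π (old s) (old t) e) → T (A (e1 e) ∨ A (e2 e))
    h e p with T∨ {side' (old s) (old t) (π (e1 e)) ∧ side' (old t) (old s) (π (e2 e))} p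
    ... | inj₁ q with T∧ {side' (old s) (old t) (π (e1 e))} q
    ...   | a , b = cr1 e (subst (Side s t) (P-new (e1 e)) (side-proj (sd a)))
                          (subst (Side t s) (P-new (e2 e)) (side-proj (sd b)))
    h e p | inj₂ q with T∧ {side' (old t) (old s) (π (e1 e))} q
    ...   | a , b = cr2 e (subst (Side t s) (P-new (e1 e)) (side-proj (sd a)))
                          (subst (Side s t) (P-new (e2 e)) (side-proj (sd b)))
  ... | inj₂ (inj₁ (j , refl , refl)) = leafcase j (inj₂ (refl , refl))
  ... | inj₂ (inj₂ (j , refl , refl)) = leafcase j (inj₁ (refl , refl))

  small-bags : ∀ s → AtMost 1 (λ v → π v ≡ s) × (∀ v → π v ≡ s → IsLeaf adj' s)
  small-bags s = AtMost1 (λ x y p q → new-inj (trans p (sym q)))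
               , λ v eq → subst (IsLeaf adj') eq (leaf-isLeaf v)

-- Arithmetic of the degree bound, with η = suc e: the three kinds of
-- vertices of R_t have degree at most η·d (new vertices), d + d·e (vertices
-- of X_t outside Z) and η·d + η·d·e (the identified vertex), all bounded
-- by (d + 1)·η·η + d.
eqX : ∀ d e → suc e * (d + d * e) ≡ d * (suc e * suc e)
eqX = solve 2 (λ d e → (con 1 :+ e) :* (d :+ d :* e) := d :* ((con 1 :+ e) :* (con 1 :+ e))) refl
  where open +-*-Solver

eqS : ∀ d e → (d + 1) * suc e * suc e + d ≡ d * (suc e * suc e) + (suc e * suc e + d)
eqS = solve 2 (λ d e → (d :+ con 1) :* (con 1 :+ e) :* (con 1 :+ e) :+ d :=
                        d :* ((con 1 :+ e) :* (con 1 :+ e)) :+ ((con 1 :+ e) :* (con 1 :+ e) :+ d)) refl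
  where open +-*-Solver

degree-core-bound : ∀ d e → suc e * (d + d * e) ≤ (d + 1) * suc e * suc e + d
degree-core-bound d e = subst₂ _≤_ (sym (eqX d e)) (sym (eqS d e)) (m≤m+n _ _)

bound-identified : ∀ d e → suc e * d + suc e * (d * e) ≤ (d + 1) * suc e * suc e + d
bound-identified d e = subst (_≤ (d + 1) * suc e * suc e + d) (*-distribˡ-+ (suc e) d (d * e)) (degree-core-bound d e)

bound-plain : ∀ d e → d + d * e ≤ (d + 1) * suc e * suc e + d
bound-plain d e = ≤-trans (m≤m+n (d + d * e) (e * (d + d * e))) (degree-core-bound d e)

bound-child : ∀ d e → suc e * d + 0 ≤ (d + 1) * suc e * suc e + d
bound-child d e = ≤-trans (subst (_≤ suc e * d + suc e * (d * e)) (sym (+-identityʳ (suc e * d))) (m≤m+n _ _)) (bound-identified d e)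

-- With p the parent and c ranging over
-- the children of t:
--   Z    = Zb = X_t ∩ X_p, identified to one vertex of Q;
--   Nb c = vertices of X_t ∩ X_c having an edge of G into the c-side;
--   H    = torso of (T, X) at t minus the edges inside Z, with the virtual
--          edges restricted to pairs inside some Nb c;
--   R    = Q plus one new vertex per node of T, the edges F joining a child
--          c to Nb c (images of the G-edges into the c-side).
-- The torso of (T', π) at t embeds into R: a leaf of a vertex homed at t
-- goes to that vertex, the parent to the identified vertex (or to itself
-- if Z is empty), a child c to the new vertex c.  ekind classifies the
-- torso edges by the four facts of EdgeThroughBag.
module TorsoModel (d η : ℕ) {n m : ℕ} (G : FinGraph n m) (maxdeg : MaxDeg≤ (toGraph G) d)
             {k : ℕ} (adj : Fin k → Fin k → Bool) (X : Fin k → Fin n → Bool)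
             (td : IsTreeDecomposition G adj X) (adh : TDAdhesion≤ G adj X η) (r : Fin k)
             (t : Fin k) where
  open IsTreeDecomposition td
  open Construction d η G maxdeg adj X td adh r

  IsPar : Fin k → Set
  IsPar c = T (adj t c) × Side c t r

  IsChild : Fin k → Set
  IsChild c = T (adj t c) × ¬ Side c t r

  opaque
    sideb : Fin k → Fin k → Bool
    sideb c y = reach (noE c t) c y

    upb : Fin k → Bool
    upb c = sideb c r

    parb : Fin k → Bool
    parb c = adj t c ∧ upb c

    childb : Fin k → Bool
    childb c = adj t c ∧ not (upb c)

    parb→ : ∀ {c} → T (parb c) → IsPar c
    parb→ {c} p with T∧ {adj t c} p
    ... | a , b = a , reach→Path _ c b

    →parb : ∀ {c} → IsPar c → T (parb c)
    →parb {c} (a , b) = ∧T {adj t c} a (Path→reach _ c b)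

    childb→ : ∀ {c} → T (childb c) → IsChild c
    childb→ {c} p with T∧ {adj t c} p
    ... | a , b = a , λ s → Tnot b (Path→reach _ c s)

    →childb : ∀ {c} → IsChild c → T (childb c)
    →childb {c} (a , b) = ∧T {adj t c} a (notT λ q → b (reach→Path _ c q))

    Zb : Fin n → Bool
    Zb w = X t w ∧ anyF (λ p → parb p ∧ X p w)

    Zb→ : ∀ {w} → T (Zb w) → T (X t w) × Σ (Fin k) λ p → IsPar p × T (X p w)
    Zb→ {w} z with T∧ {X t w} z
    ... | a , b with anyF-elim _ b
    ... | p , q with T∧ {parb p} q
    ... | q1 , q2 = a , p , parb→ q1 , q2

    →Zb : ∀ {w p} → T (X t w) → IsPar p → T (X p w) → T (Zb w)
    →Zb {w} {p} a pr b = ∧T {X t w} a (anyF-intro _ p (∧T {parb p} (→parb pr) b))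

    crossb : Fin k → Fin n → Fin m → Bool
    crossb c v e = (e1 e == v ∧ sideb c (home (e2 e))) ∨ (e2 e == v ∧ sideb c (home (e1 e)))

    Nb : Fin k → Fin n → Bool
    Nb c v = X t v ∧ X c v ∧ anyF (crossb c v)

    Nb→ : ∀ {c v} → T (Nb c v) → T (X t v) × T (X c v)
    Nb→ {c} {v} p with T∧ {X t v} p
    ... | a , b = a , proj₁ (T∧ {X c v} b)

    cross1 : ∀ c e → Side c t (home (e2 e)) → T (anyF (crossb c (e1 e)))
    cross1 c e s = anyF-intro _ e (∨Tl {e1 e == e1 e ∧ sideb c (home (e2 e))}
                     (∧T {e1 e == e1 e} (==refl (e1 e)) (Path→reach (noE c t) c s)))

    cross2 : ∀ c e → Side c t (home (e1 e)) → T (anyF (crossb c (e2 e)))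
    cross2 c e s = anyF-intro _ e (∨Tr {e1 e == e2 e ∧ sideb c (home (e2 e))}
                     (∧T {e2 e == e2 e} (==refl (e2 e)) (Path→reach (noE c t) c s)))

    mkNb : ∀ {c v} → T (X t v) → T (X c v) → T (anyF (crossb c v)) → T (Nb c v)
    mkNb {c} {v} a b q = ∧T {X t v} a (∧T {X c v} b q)

    Nb-cross : ∀ {c v} → T (Nb c v) → T (anyF (crossb c v))
    Nb-cross {c} {v} p = proj₂ (T∧ {X c v} (proj₂ (T∧ {X t v} p)))

    crossInfo : ∀ c u → T (anyF (crossb c u)) →
      Σ (Fin m × Bool) λ h → (end (toGraph G) h ≡ u) × Side c t (home (end (toGraph G) (proj₁ h , not (proj₂ h))))
    crossInfo c u p with anyF-elim _ p
    ... | e , q with T∨ {e1 e == u ∧ sideb c (home (e2 e))} q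
    ...   | inj₁ z = (e , true) , ==→≡ (proj₁ (T∧ {e1 e == u} z)) , reach→Path _ c (proj₂ (T∧ {e1 e == u} z))
    ...   | inj₂ z = (e , false) , ==→≡ (proj₁ (T∧ {e2 e == u} z)) , reach→Path _ c (proj₂ (T∧ {e2 e == u} z))

  par-or-child : ∀ {c} → T (adj t c) → IsPar c ⊎ IsChild c
  par-or-child {c} a with decSide c t r
  ... | yes s = inj₁ (a , s)
  ... | no ns = inj₂ (a , ns)

  par-uniq : ∀ {p1 p2} → IsPar p1 → IsPar p2 → p1 ≡ p2
  par-uniq {p1} {p2} (a1 , s1) (a2 , s2) with p1 Fin.≟ p2
  ... | yes q = q
  ... | no nq = ⊥-elim (sides-disj a1 a2 nq s1 s2)

  par≢child : ∀ {p c} → IsPar p → IsChild c → p ≢ c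
  par≢child (_ , s) (_ , ns) refl = ns s

  home-t-notpar : ∀ {u p} → home u ≡ t → IsPar p → ¬ T (X p u)
  home-t-notpar {u} {p} h (a , s) xp =
    home-minimal {t = p} {c = t} {v = u} (adj-sym t p a) (λ s' → side-disj (adj-sym t p a) s s')
      (subst (Side t p) (sym h) here) xp

  child-notXt : ∀ {c v} → IsChild c → Side c t (home v) → ¬ T (X t v)
  child-notXt (a , ns) s = home-minimal a ns s

  -- Where an edge uw of G (both ends in a bag b) can go, relative to t:
  -- each fact walks from home u or home w to b inside the bags of the
  -- vertex and applies exit / home-minimal.
  module EdgeThroughBag {u w : Fin n} {b : Fin k} (xbu : T (X b u)) (xbw : T (X b w)) where
    homed-at-t-to-child : ∀ {c} → home u ≡ t → IsChild c → Side c t (home w) → T (X c u)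
    homed-at-t-to-child {c} h ch sw with decSide c t b
    ... | yes sb = proj₁ (exit (λ z → X z u) (adj-sym t c (proj₁ ch)) (walk u xbu (home-in u)) sb
                      (λ s → t-not-side (proj₁ ch) (subst (Side c t) h s)))
    ... | no nb = ⊥-elim (child-notXt ch sw
                    (proj₂ (exit (λ z → X z w) (adj-sym t c (proj₁ ch)) (walk w (home-in w) xbw) sw nb)))

    homed-at-t-to-parent : ∀ {p} → home u ≡ t → IsPar p → Side p t (home w) → T (X t w) × T (X p w)
    homed-at-t-to-parent {p} h pr sw with decSide p t b
    ... | yes sb = ⊥-elim (home-t-notpar h pr
                    (proj₁ (exit (λ z → X z u) (adj-sym t p (proj₁ pr)) (walk u xbu (home-in u)) sb
                      (λ s → t-not-side (proj₁ pr) (subst (Side p t) h s)))))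
    ... | no nb = let z = exit (λ z → X z w) (adj-sym t p (proj₁ pr)) (walk w (home-in w) xbw) sw nb
                  in proj₂ z , proj₁ z

    child-to-parent : ∀ {c p} → IsChild c → Side c t (home u) → IsPar p → Side p t (home w) →
           T (X t w) × T (X c w) × T (X p w)
    child-to-parent {c} {p} ch su pr sw with decSide c t b
    ... | no nb = ⊥-elim (child-notXt ch su
                    (proj₂ (exit (λ z → X z u) (adj-sym t c (proj₁ ch)) (walk u (home-in u) xbu) su nb)))
    ... | yes sb =
      let nbp : ¬ Side p t b
          nbp = λ s → sides-disj (proj₁ ch) (proj₁ pr) (λ eq → par≢child pr ch (sym eq)) sb s
          z1 = exit (λ z → X z w) (adj-sym t p (proj₁ pr)) (walk w (home-in w) xbw) sw nbp
          z2 = exit (λ z → X z w) (adj-sym t c (proj₁ ch)) (walk w xbw (home-in w)) sb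
                 (λ s → sides-disj (proj₁ ch) (proj₁ pr) (λ eq → par≢child pr ch (sym eq)) s sw)
      in proj₂ z1 , proj₁ z2 , proj₁ z1

    not-two-children : ∀ {c1 c2} → IsChild c1 → IsChild c2 → c1 ≢ c2 → Side c1 t (home u) → Side c2 t (home w) → ⊥
    not-two-children {c1} {c2} ch1 ch2 ne su sw with decSide c1 t b | decSide c2 t b
    ... | no nb | _ = child-notXt ch1 su
                    (proj₂ (exit (λ z → X z u) (adj-sym t c1 (proj₁ ch1)) (walk u (home-in u) xbu) su nb))
    ... | yes _ | no nb = child-notXt ch2 sw
                    (proj₂ (exit (λ z → X z w) (adj-sym t c2 (proj₁ ch2)) (walk w (home-in w) xbw) sw nb))
    ... | yes s1 | yes s2 = sides-disj (proj₁ ch1) (proj₁ ch2) ne s1 s2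

  Z-count : countF Zb ≤ η
  Z-count with decT (anyF parb)
  ... | yes q with anyF-elim _ q
  ...   | p , pp = ≤-trans (countF-mono Zb (λ w → X t w ∧ X p w) h) (adh t p (proj₁ (parb→ pp)))
    where
    h : ∀ w → T (Zb w) → T (X t w ∧ X p w)
    h w z with Zb→ z
    ... | a , p' , pr' , b rewrite par-uniq pr' (parb→ pp) = ∧T {X t w} a b
  Z-count | no nq = subst (_≤ η) (sym (countF-false Zb h)) z≤n
    where
    h : ∀ w → ¬ T (Zb w)
    h w z with Zb→ z
    ... | _ , p , pr , _ = nq (anyF-intro _ p (→parb pr))

  Tor : Graph
  Tor = torsoTD G adj X t

  keepH : E Tor → Bool
  keepH (inj₁ (e , _)) = not (Zb (e1 e) ∧ Zb (e2 e))
  keepH (inj₂ ((a , b) , _)) = not (Zb a ∧ Zb b) ∧ anyF (λ c → childb c ∧ Nb c a ∧ Nb c b)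

  H : Graph
  H = record { V = V Tor ; E = Σ (E Tor) (λ τ → T (keepH τ)) ; ends = λ h → ends Tor (proj₁ h) }

  H⊑Tor : H ⊑ Tor
  H⊑Tor = record
    { vmap = λ x → x
    ; emap = proj₁
    ; vmap-inj = λ x y eq → eq
    ; emap-inj = λ x y eq → Σ-irr {B = keepH} eq
    ; ends-ok = λ e → inj₁ refl
    }

  -- Q = H with Z identified: vertex set "Z is nonempty" ⊎ (X_t - Z)
  VQ : Set
  VQ = T (anyF Zb) ⊎ Σ (Fin n) (λ v → T (X t v ∧ not (Zb v)))

  φd : ∀ v → T (X t v) → Dec (T (Zb v)) → VQ
  φd v p (yes z) = inj₁ (anyF-intro Zb v z)
  φd v p (no nz) = inj₂ (v , ∧T {X t v} p (notT nz))

  φ : V H → VQ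
  φ (v , p) = φd v p (decT (Zb v))

  φ-Z : ∀ v p → T (Zb v) → Σ (T (anyF Zb)) λ pz → φ (v , p) ≡ inj₁ pz
  φ-Z v p z with decT (Zb v)
  ... | yes _ = _ , refl
  ... | no nz = ⊥-elim (nz z)

  φ-nZ : ∀ v p → ¬ T (Zb v) → Σ (T (X t v ∧ not (Zb v))) λ q → φ (v , p) ≡ inj₂ (v , q)
  φ-nZ v p nz with decT (Zb v)
  ... | yes z = ⊥-elim (nz z)
  ... | no _ = _ , refl

  inj₁-irr : ∀ {p q : T (anyF Zb)} → _≡_ {A = VQ} (inj₁ p) (inj₁ q)
  inj₁-irr {p} {q} = cong inj₁ (T-irrelevant p q)

  inj₂-irr : ∀ {v w} {p : T (X t v ∧ not (Zb v))} {q : T (X t w ∧ not (Zb w))} → v ≡ w →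
    _≡_ {A = VQ} (inj₂ (v , p)) (inj₂ (w , q))
  inj₂-irr {v} {p = p} {q = q} refl = cong (λ z → inj₂ (v , z)) (T-irrelevant p q)

  φ-irr : ∀ v p q → φ (v , p) ≡ φ (v , q)
  φ-irr v p q = cong (λ z → φ (v , z)) (T-irrelevant p q)

  ZH : V H → Set
  ZH x = T (Zb (proj₁ x))

  Q : Graph
  Q = record { V = VQ ; E = E H ; ends = λ h → map φ φ (ends H h) }

  ident : Identification H ZH Q
  ident = record
    { φ = φ
    ; φ-surj = surj
    ; φ-fibres = fib
    ; φ-glue = glue
    ; ψ = λ e → e
    ; ψ⁻ = λ e → e
    ; ψ⁻ψ = λ e → refl
    ; ψψ⁻ = λ e → refl
    ; ends-ψ = λ e → refl
    }
    where
    surj : ∀ q → Σ (V H) λ x → φ x ≡ q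
    surj (inj₁ pz) with anyF-elim Zb pz
    ... | w , z = (w , proj₁ (Zb→ z)) , trans (proj₂ (φ-Z w _ z)) inj₁-irr
    surj (inj₂ (v , q)) with T∧ {X t v} q
    ... | a , b = (v , a) , trans (proj₂ (φ-nZ v a (Tnot b))) (inj₂-irr refl)
    fib : ∀ x y → φ x ≡ φ y → (x ≡ y) ⊎ (ZH x × ZH y)
    fib (v , p) (w , q) eq = fib' (decT (Zb v)) (decT (Zb w))
     where
     fib' : Dec (T (Zb v)) → Dec (T (Zb w)) → ((v , p) ≡ (w , q)) ⊎ (ZH (v , p) × ZH (w , q))
     fib' (yes z1) (yes z2) = inj₂ (z1 , z2)
     fib' (yes z1) (no z2) = ⊥-elim (inj₁≢inj₂ (trans (sym (proj₂ (φ-Z v p z1))) (trans eq (proj₂ (φ-nZ w q z2)))))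
     fib' (no z1) (yes z2) = ⊥-elim (inj₁≢inj₂ (trans (sym (proj₂ (φ-Z w q z2))) (trans (sym eq) (proj₂ (φ-nZ v p z1)))))
     fib' (no z1) (no z2) = inj₁ (Σ-irr {B = X t} (lem (trans (sym (proj₂ (φ-nZ v p z1))) (trans eq (proj₂ (φ-nZ w q z2))))))
      where
      lem : ∀ {a b} {pa : T (X t a ∧ not (Zb a))} {pb : T (X t b ∧ not (Zb b))} →
            _≡_ {A = VQ} (inj₂ (a , pa)) (inj₂ (b , pb)) → a ≡ b
      lem refl = refl
    glue : ∀ x y → ZH x → ZH y → φ x ≡ φ y
    glue (v , p) (w , q) z1 z2 = trans (proj₂ (φ-Z v p z1)) (trans inj₁-irr (sym (proj₂ (φ-Z w q z2))))

  Z-small : AtMost η ZH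
  Z-small = AtMost-inj (λ x _ → proj₁ x) (λ x y _ _ eq → Σ-irr {B = X t} eq) (λ x z → z)
              (AtMost-mono Z-count (AtMost-countF Zb))

  TCD : Graph
  TCD = torsoTCD G adj' π (old t)

  data Kind (x : Fin (k + n)) : Set where
    kL : (j : Fin n) → x ≡ new j → home j ≡ t → Kind x
    kB : (c : Fin k) → x ≡ old c → T (adj t c) → Kind x

  kind : ∀ x → T (adj' (old t) x) → Kind x
  kind x a with edgeK (old t) x a
  ... | inj₁ (s , c , eq1 , eq2 , e) = kB c eq2 (subst (λ z → T (adj z c)) (sym (old-inj eq1)) e)
  ... | inj₂ (inj₁ (j , eq1 , eq2)) = kL j eq2 (old-inj (sym eq1))
  ... | inj₂ (inj₂ (j , eq1 , _)) = ⊥-elim (old≢new eq1)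

  -- vertices of R: those of Q and one new vertex per node of T
  VR : Set
  VR = VQ ⊎ Fin k

  bmapd : (c : Fin k) → Dec (T (parb c)) → Dec (T (anyF Zb)) → VR
  bmapd c (yes _) (yes pz) = inj₁ (inj₁ pz)
  bmapd c (yes _) (no _) = inj₂ c
  bmapd c (no _) _ = inj₂ c

  bmap : Fin k → VR
  bmap c = bmapd c (decT (parb c)) (decT (anyF Zb))

  bmap-par : ∀ {c} → IsPar c → (pz : T (anyF Zb)) → bmap c ≡ inj₁ (inj₁ pz)
  bmap-par {c} pr pz = lem (decT (parb c)) (decT (anyF Zb))
    where
    lem : (d1 : Dec (T (parb c))) (d2 : Dec (T (anyF Zb))) → bmapd c d1 d2 ≡ inj₁ (inj₁ pz)
    lem (yes _) (yes q) = cong inj₁ inj₁-irr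
    lem (yes _) (no nq) = ⊥-elim (nq pz)
    lem (no np) _ = ⊥-elim (np (→parb pr))

  bmap-parZ : ∀ {c} → IsPar c → ¬ T (anyF Zb) → bmap c ≡ inj₂ c
  bmap-parZ {c} pr nz = lem (decT (parb c)) (decT (anyF Zb))
    where
    lem : (d1 : Dec (T (parb c))) (d2 : Dec (T (anyF Zb))) → bmapd c d1 d2 ≡ inj₂ c
    lem (yes _) (yes q) = ⊥-elim (nz q)
    lem (yes _) (no nq) = refl
    lem (no np) _ = refl

  bmap-child : ∀ {c} → IsChild c → bmap c ≡ inj₂ c
  bmap-child {c} ch = lem (decT (parb c)) (decT (anyF Zb))
    where
    lem : (d1 : Dec (T (parb c))) (d2 : Dec (T (anyF Zb))) → bmapd c d1 d2 ≡ inj₂ c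
    lem (yes p) _ = ⊥-elim (proj₂ ch (proj₂ (parb→ p)))
    lem (no np) _ = refl

  leafQ : ∀ j → home j ≡ t → T (X t j ∧ not (Zb j))
  leafQ j h = ∧T {X t j} (subst (λ s → T (X s j)) h (home-in j))
                (notT (λ z → home-t-notpar h (proj₁ (proj₂ (proj₂ (Zb→ z)))) (proj₂ (proj₂ (proj₂ (Zb→ z))))))

  vmapK : ∀ {x} → Kind x → VR
  vmapK (kL j _ h) = inj₁ (inj₂ (j , leafQ j h))
  vmapK (kB c _ _) = bmap c

  VC : Set
  VC = V TCD

  noInj₁ : ∀ {v} → T (π v == old t) → ⊥
  noInj₁ p = old≢new (sym (==→≡ p))

  -- the vertex map of the embedding (the torso has no vertex of X'_t,
  -- since every bag of T' at an old node is empty)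
  vmap : VC → VR
  vmap (inj₁ (v , p)) = ⊥-elim (noInj₁ {v} p)
  vmap (inj₂ (x , a)) = vmapK (kind x a)

  data VK : VC → Set where
    vL : ∀ j (a : T (adj' (old t) (new j))) → (h : home j ≡ t) →
         vmap (inj₂ (new j , a)) ≡ inj₁ (inj₂ (j , leafQ j h)) → VK (inj₂ (new j , a))
    vB : ∀ c (a : T (adj' (old t) (old c))) → T (adj t c) →
         vmap (inj₂ (old c , a)) ≡ bmap c → VK (inj₂ (old c , a))

  vk : ∀ x → VK x
  vk (inj₁ (v , p)) = ⊥-elim (noInj₁ {v} p)
  vk (inj₂ (x , a)) with kind x a in eq
  ... | kL j refl h = vL j a h (cong vmapK eq)
  ... | kB c refl e = vB c a e (cong vmapK eq)

  Rep : VC → Fin n → Set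
  Rep (inj₁ (u , _)) v = T (u == v)
  Rep (inj₂ (x , _)) v = T (reach (noV' (old t)) x (new v))

  rep-L : ∀ {j v} → home j ≡ t → T (reach (noV' (old t)) (new j) (new v)) → v ≡ j
  rep-L {j} {v} h rp = new-inj (leaf-branch h (reach→Path (noV' (old t)) (new j) rp))

  rep-B : ∀ {c v} → T (reach (noV' (old t)) (old c) (new v)) → Side c t (home v)
  rep-B {c} {v} rp = Br→Side (subst (Br t c) (P-new v) (br-proj (reach→Path (noV' (old t)) (old c) rp)))

  VC-eq : ∀ {x0 x1} {a : T (adj' (old t) x0)} {b : T (adj' (old t) x1)} → x0 ≡ x1 →
    _≡_ {A = VC} (inj₂ (x0 , a)) (inj₂ (x1 , b))
  VC-eq {a = a} {b = b} refl = cong (λ z → inj₂ (_ , z)) (T-irrelevant a b)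

  rep-uniq : ∀ x x' v → Rep x v → Rep x' v → x ≡ x'
  rep-uniq x x' v r r' with vk x | vk x'
  ... | vL j a h _ | vL j' a' h' _ = VC-eq (cong new (trans (sym (rep-L h r)) (rep-L h' r')))
  ... | vL j a h _ | vB c a' e' _ with rep-L h r
  ...   | refl = ⊥-elim (t-not-side e' (subst (Side c t) h (rep-B r')))
  rep-uniq x x' v r r' | vB c a e _ | vL j a' h' _ with rep-L h' r'
  ...   | refl = ⊥-elim (t-not-side e (subst (Side c t) h' (rep-B r)))
  rep-uniq x x' v r r' | vB c a e _ | vB c' a' e' _ with c Fin.≟ c'
  ... | yes refl = VC-eq refl
  ... | no ne = ⊥-elim (sides-disj e e' ne (rep-B r) (rep-B r'))

  bmap-shape : ∀ c → T (adj t c) → (IsPar c × Σ (T (anyF Zb)) λ pz → bmap c ≡ inj₁ (inj₁ pz)) ⊎ (bmap c ≡ inj₂ c)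
  bmap-shape c a with par-or-child a
  ... | inj₂ ch = inj₂ (bmap-child ch)
  ... | inj₁ pr = shape2 (decT (anyF Zb))
    where
    shape2 : Dec (T (anyF Zb)) → (IsPar c × Σ (T (anyF Zb)) λ pz → bmap c ≡ inj₁ (inj₁ pz)) ⊎ (bmap c ≡ inj₂ c)
    shape2 (yes pz) = inj₁ (pr , pz , bmap-par pr pz)
    shape2 (no nz) = inj₂ (bmap-parZ pr nz)

  leaf-label : ∀ {j j' p q} → _≡_ {A = VR} (inj₁ (inj₂ (j , p))) (inj₁ (inj₂ (j' , q))) → j ≡ j'
  leaf-label refl = refl

  leaf≢bmap : ∀ {j q c} → T (adj t c) → _≢_ {A = VR} (inj₁ (inj₂ (j , q))) (bmap c)
  leaf≢bmap {c = c} ac eq with bmap-shape c ac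
  ... | inj₁ (_ , _ , s) with trans eq s
  ...   | ()
  leaf≢bmap {c = c} ac eq | inj₂ s with trans eq s
  ...   | ()

  -- distinct neighbours of t have distinct images (only the parent can
  -- be sent into Q)
  bmap-inj : ∀ {c c'} → T (adj t c) → T (adj t c') → bmap c ≡ bmap c' → c ≡ c'
  bmap-inj {c} {c'} ac ac' eq with bmap-shape c ac | bmap-shape c' ac'
  ... | inj₁ (pr , _) | inj₁ (pr' , _) = par-uniq pr pr'
  ... | inj₁ (_ , _ , s) | inj₂ s' with trans (sym s) (trans eq s')
  ...   | ()
  bmap-inj ac ac' eq | inj₂ s | inj₁ (_ , _ , s') with trans (sym s) (trans eq s')
  ...   | ()
  bmap-inj ac ac' eq | inj₂ s | inj₂ s' = inj₂-injective (trans (sym s) (trans eq s'))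

  vmap-inj : ∀ x y → vmap x ≡ vmap y → x ≡ y
  vmap-inj x y eq with vk x | vk y
  ... | vL j a h e | vL j' a' h' e' = VC-eq (cong new (leaf-label (trans (sym e) (trans eq e'))))
  ... | vL j a h e | vB c a' ac e' = ⊥-elim (leaf≢bmap ac (trans (sym e) (trans eq e')))
  ... | vB c a ac e | vL j a' h e' = ⊥-elim (leaf≢bmap ac (trans (sym e') (trans (sym eq) e)))
  ... | vB c a ac e | vB c' a' ac' e' = VC-eq (cong old (bmap-inj ac ac' (trans (sym e) (trans eq e'))))

  EC : Set
  EC = E TCD

  εe : EC → Fin m
  εe = proj₁

  εx εy : EC → VC
  εx ε = proj₁ (proj₁ (proj₂ ε))
  εy ε = proj₂ (proj₁ (proj₂ ε))

  εrx : ∀ ε → Rep (εx ε) (e1 (εe ε))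
  εrx (e , (inj₁ _ , _) , rx , _) = rx
  εrx (e , (inj₂ _ , _) , rx , _) = rx

  εry : ∀ ε → Rep (εy ε) (e2 (εe ε))
  εry (e , (_ , inj₁ _) , _ , ry , _) = ry
  εry (e , (_ , inj₂ _) , _ , ry , _) = ry

  εnl : ∀ ε {c a b} → εx ε ≡ inj₂ (old c , a) → εy ε ≡ inj₂ (old c , b) → ⊥
  εnl (e , (inj₂ (x0 , _) , inj₂ (y0 , _)) , _ , _ , nl) {c} refl refl = Tnot nl (==refl (old c))

  tcd-uniq : ∀ ε ε' → εe ε ≡ εe ε' → ε ≡ ε'
  tcd-uniq ε ε' eq with rep-uniq (εx ε) (εx ε') (e1 (εe ε)) (εrx ε) (subst (λ z → Rep (εx ε') (e1 z)) (sym eq) (εrx ε'))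
                     | rep-uniq (εy ε) (εy ε') (e2 (εe ε)) (εry ε) (subst (λ z → Rep (εy ε') (e2 z)) (sym eq) (εry ε'))
  tcd-uniq (e , (x , y) , rx , ry , nl) (.e , (.x , .y) , rx' , ry' , nl') refl | refl | refl =
    cong (λ z → (e , (x , y) , z)) (cong₂ _,_ (T-irrelevant rx rx') (cong₂ _,_ (T-irrelevant ry ry') (T-irrelevant nl nl')))

  Good : VC → Fin n → Set
  Good x v = ∀ p → vmap x ≡ inj₁ (φ (v , p))

  VClass : VC → Fin n → Set
  VClass x v = (home v ≡ t × Good x v)
             ⊎ (Σ (Fin k) λ c → T (adj t c) × Side c t (home v) × (vmap x ≡ bmap c) × Σ (T (adj' (old t) (old c))) λ a → x ≡ inj₂ (old c , a))

  vclass : ∀ x v → Rep x v → VClass x v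
  vclass x v r with vk x
  ... | vL j a h e with rep-L h r
  ...   | refl = inj₁ (h , λ p → trans e (cong inj₁ (sym (trans (proj₂ (φ-nZ v p nz)) (inj₂-irr refl)))))
    where
    nz : ¬ T (Zb v)
    nz z = Tnot (proj₂ (T∧ {X t v} (leafQ v h))) z
  vclass x v r | vB c a ac e = inj₂ (c , ac , rep-B r , e , a , refl)

  goodPar : ∀ {x v c} → vmap x ≡ bmap c → IsPar c → T (Zb v) → Good x v
  goodPar {x} {v} {c} e pr z p = trans e (trans (bmap-par pr (anyF-intro Zb v z)) (cong inj₁ (trans inj₁-irr (sym (proj₂ (φ-Z v p z))))))

  data EKind (ε : EC) : Set where
    eH : (p1 : T (X t (e1 (εe ε)))) (p2 : T (X t (e2 (εe ε)))) → T (not (Zb (e1 (εe ε)) ∧ Zb (e2 (εe ε)))) →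
         Good (εx ε) (e1 (εe ε)) → Good (εy ε) (e2 (εe ε)) → EKind ε
    eF1 : (c : Fin k) → IsChild c → vmap (εx ε) ≡ inj₂ c → ¬ T (X t (e1 (εe ε))) →
          Good (εy ε) (e2 (εe ε)) → T (Nb c (e2 (εe ε))) → EKind ε
    eF2 : (c : Fin k) → IsChild c → vmap (εy ε) ≡ inj₂ c → ¬ T (X t (e2 (εe ε))) →
          Good (εx ε) (e1 (εe ε)) → T (Nb c (e1 (εe ε))) → EKind ε

  leafX : ∀ {v} → home v ≡ t → T (X t v)
  leafX {v} h = subst (λ s → T (X s v)) h (home-in v)

  leafNZ : ∀ {v} → home v ≡ t → ¬ T (Zb v)
  leafNZ {v} h z = Tnot (proj₂ (T∧ {X t v} (leafQ v h))) z

  notZboth1 : ∀ {a b} → ¬ T (Zb a) → T (not (Zb a ∧ Zb b))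
  notZboth1 {a} na = notT (λ q → na (proj₁ (T∧ {Zb a} q)))

  notZboth2 : ∀ {a b} → ¬ T (Zb b) → T (not (Zb a ∧ Zb b))
  notZboth2 {a} nb = notT (λ q → nb (proj₂ (T∧ {Zb a} q)))

  ekind : ∀ ε → EKind ε
  ekind ε with edges (εe ε) | vclass (εx ε) _ (εrx ε) | vclass (εy ε) _ (εry ε)
  ... | b , xb1 , xb2 | inj₁ (h1 , g1) | inj₁ (h2 , g2) =
        eH (leafX h1) (leafX h2) (notZboth1 (leafNZ h1)) g1 g2
  ... | b , xb1 , xb2 | inj₁ (h1 , g1) | inj₂ (c , ac , s2 , m2 , _) with par-or-child ac
  ...   | inj₁ pr = let z = EdgeThroughBag.homed-at-t-to-parent xb1 xb2 h1 pr s2 in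
                    eH (leafX h1) (proj₁ z) (notZboth1 (leafNZ h1)) g1
                       (goodPar {εy ε} m2 pr (→Zb (proj₁ z) pr (proj₂ z)))
  ...   | inj₂ ch = eF2 c ch (trans m2 (bmap-child ch)) (child-notXt ch s2) g1
                       (mkNb (leafX h1) (EdgeThroughBag.homed-at-t-to-child xb1 xb2 h1 ch s2) (cross1 c (εe ε) s2))
  ekind ε | b , xb1 , xb2 | inj₂ (c , ac , s1 , m1 , _) | inj₁ (h2 , g2) with par-or-child ac
  ...   | inj₁ pr = let z = EdgeThroughBag.homed-at-t-to-parent xb2 xb1 h2 pr s1 in
                    eH (proj₁ z) (leafX h2) (notZboth2 (leafNZ h2))
                       (goodPar {εx ε} m1 pr (→Zb (proj₁ z) pr (proj₂ z))) g2
  ...   | inj₂ ch = eF1 c ch (trans m1 (bmap-child ch)) (child-notXt ch s1) g2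
                       (mkNb (leafX h2) (EdgeThroughBag.homed-at-t-to-child xb2 xb1 h2 ch s1) (cross2 c (εe ε) s1))
  ekind ε | b , xb1 , xb2 | inj₂ (c1 , ac1 , s1 , m1 , a1 , q1) | inj₂ (c2 , ac2 , s2 , m2 , a2 , q2) with c1 Fin.≟ c2
  ... | yes refl = ⊥-elim (εnl ε q1 q2)
  ... | no ne with par-or-child ac1 | par-or-child ac2
  ...   | inj₁ pr1 | inj₁ pr2 = ⊥-elim (ne (par-uniq pr1 pr2))
  ...   | inj₂ ch1 | inj₂ ch2 = ⊥-elim (EdgeThroughBag.not-two-children xb1 xb2 ch1 ch2 ne s1 s2)
  ...   | inj₂ ch1 | inj₁ pr2 = let z = EdgeThroughBag.child-to-parent xb1 xb2 ch1 s1 pr2 s2 in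
          eF1 c1 ch1 (trans m1 (bmap-child ch1)) (child-notXt ch1 s1)
              (goodPar {εy ε} m2 pr2 (→Zb (proj₁ z) pr2 (proj₂ (proj₂ z))))
              (mkNb (proj₁ z) (proj₁ (proj₂ z)) (cross2 c1 (εe ε) s1))
  ...   | inj₁ pr1 | inj₂ ch2 = let z = EdgeThroughBag.child-to-parent xb2 xb1 ch2 s2 pr1 s1 in
          eF2 c2 ch2 (trans m2 (bmap-child ch2)) (child-notXt ch2 s2)
              (goodPar {εx ε} m1 pr1 (→Zb (proj₁ z) pr1 (proj₂ (proj₂ z))))
              (mkNb (proj₁ z) (proj₁ (proj₂ z)) (cross1 c2 (εe ε) s2))

  IsF : ∀ {ε} → EKind ε → Set
  IsF (eH _ _ _ _ _) = ⊥
  IsF (eF1 _ _ _ _ _ _) = ⊤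
  IsF (eF2 _ _ _ _ _ _) = ⊤

  F : Set
  F = Σ EC λ ε → IsF (ekind ε)

  fe : F → VR × VR
  fe (ε , _) = vmap (εx ε) , vmap (εy ε)

  R : Graph
  R = addVertices Q (Fin k) F fe

  isNew-inj₂ : ∀ {a : VR} {c} → a ≡ inj₂ c → IsNew a
  isNew-inj₂ refl = tt

  notNew-good : ∀ {x v} → Good x v → T (X t v) → ¬ IsNew (vmap x)
  notNew-good {x} {v} g p nw with vmap x | g p
  ... | .(inj₁ _) | refl = nw

  F-incident : ∀ f → IsNew (proj₁ (fe f)) ⊎ IsNew (proj₂ (fe f))
  F-incident (ε , w) with ekind ε
  ... | eF1 c _ m _ _ _ = inj₁ (isNew-inj₂ m)
  ... | eF2 c _ m _ _ _ = inj₂ (isNew-inj₂ m)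

  I-stable : ∀ f → ¬ (IsNew (proj₁ (fe f)) × IsNew (proj₂ (fe f)))
  I-stable (ε , w) with ekind ε
  ... | eF1 c _ m _ g nb = λ q → notNew-good {εy ε} g (proj₁ (Nb→ nb)) (proj₂ q)
  ... | eF2 c _ m _ g nb = λ q → notNew-good {εx ε} g (proj₁ (Nb→ nb)) (proj₁ q)

  AdjInfo : Fin k → VR → Set
  AdjInfo i x = Σ (Fin n) λ v → Σ (T (X t v)) λ p → (x ≡ inj₁ (φ (v , p))) × IsChild i × T (Nb i v)

  adjI : ∀ i x → Adj R (inj₂ i) x → AdjInfo i x
  adjI i x (inj₁ h , inj₁ eq) = ⊥-elim (inj₁≢inj₂ (cong proj₁ eq))
  adjI i x (inj₁ h , inj₂ eq) = ⊥-elim (inj₁≢inj₂ (cong proj₂ eq))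
  adjI i x (inj₂ (ε , w) , eq) with ekind ε
  ... | eF1 c ch m nx g nb with eq
  ...   | inj₁ eq' with trans (sym m) (cong proj₁ eq')
  ...     | refl = e2 (εe ε) , proj₁ (Nb→ nb) , trans (sym (cong proj₂ eq')) (g (proj₁ (Nb→ nb))) , ch , nb
  adjI i x (inj₂ (ε , w) , eq) | eF1 c ch m nx g nb | inj₂ eq' =
    ⊥-elim (notNew-good {εy ε} g (proj₁ (Nb→ nb)) (subst IsNew (sym (cong proj₂ eq')) tt))
  adjI i x (inj₂ (ε , w) , eq) | eF2 c ch m nx g nb with eq
  ...   | inj₂ eq' with trans (sym m) (cong proj₂ eq')
  ...     | refl = e1 (εe ε) , proj₁ (Nb→ nb) , trans (sym (cong proj₁ eq')) (g (proj₁ (Nb→ nb))) , ch , nb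
  adjI i x (inj₂ (ε , w) , eq) | eF2 c ch m nx g nb | inj₁ eq' =
    ⊥-elim (notNew-good {εx ε} g (proj₁ (Nb→ nb)) (subst IsNew (sym (cong proj₁ eq')) tt))

  mkAdj : ∀ {a b} (pa : T (X t a)) (pb : T (X t b)) (τ : E Tor) → T (keepH τ) →
    (ends Tor τ ≡ ((a , pa) , (b , pb))) ⊎ (ends Tor τ ≡ ((b , pb) , (a , pa))) →
    Adj R (inj₁ (φ (a , pa))) (inj₁ (φ (b , pb)))
  mkAdj pa pb τ kp (inj₁ eq) = inj₁ (τ , kp) , inj₁ (cong (map (λ z → inj₁ (φ z)) (λ z → inj₁ (φ z))) eq)
  mkAdj pa pb τ kp (inj₂ eq) = inj₁ (τ , kp) , inj₂ (cong (map (λ z → inj₁ (φ z)) (λ z → inj₁ (φ z))) eq)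

  adjGb : Fin n → Fin n → Bool
  adjGb u w = anyF (λ e → (e1 e == u ∧ e2 e == w) ∨ (e1 e == w ∧ e2 e == u))

  adjGb-sym : ∀ u w → T (adjGb u w) → T (adjGb w u)
  adjGb-sym u w q with anyF-elim _ q
  ... | e , h with T∨ {e1 e == u ∧ e2 e == w} h
  ...   | inj₁ z = anyF-intro _ e (∨Tr {e1 e == w ∧ e2 e == u} z)
  ...   | inj₂ z = anyF-intro _ e (∨Tl {e1 e == w ∧ e2 e == u} z)

  clique-edge : ∀ {i a b} (pa : T (X t a)) (pb : T (X t b)) → IsChild i → T (Nb i a) → T (Nb i b) →
    ¬ T (Zb a ∧ Zb b) → T (toℕ a <ᵇ toℕ b) → ¬ T (adjGb a b) →
    Adj R (inj₁ (φ (a , pa))) (inj₁ (φ (b , pb)))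
  clique-edge {i} {a} {b} pa pb ch na nb nz lt nadj =
    mkAdj pa pb (inj₂ ((a , b) , pa , pb , lt , sh , notT nadj))
      (∧T {not (Zb a ∧ Zb b)} (notT nz) (anyF-intro _ i (∧T {childb i} (→childb ch) (∧T {Nb i a} na nb))))
      (inj₁ refl)
    where
    sh : T (anyF (λ t' → adj t t' ∧ X t' a ∧ X t' b))
    sh = anyF-intro _ i (∧T {adj t i} (proj₁ ch) (∧T {X i a} (proj₂ (Nb→ na)) (proj₂ (Nb→ nb))))

  N-clique : ∀ i x y → Adj R (inj₂ i) x → Adj R (inj₂ i) y → x ≢ y → Adj R x y
  N-clique i x y ax ay ne with adjI i x ax | adjI i y ay
  ... | a , pa , refl , ch , na | b , pb , refl , _ , nb = main
    where
    nz : ¬ T (Zb a ∧ Zb b)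
    nz q = ne (cong inj₁ (Identification.φ-glue ident (a , pa) (b , pb) (proj₁ (T∧ {Zb a} q)) (proj₂ (T∧ {Zb a} q))))
    ab : a ≢ b
    ab refl = ne (cong inj₁ (φ-irr a pa pb))
    swapAdj : Adj R (inj₁ (φ (b , pb))) (inj₁ (φ (a , pa))) → Adj R (inj₁ (φ (a , pa))) (inj₁ (φ (b , pb)))
    swapAdj (r , inj₁ eq) = r , inj₂ eq
    swapAdj (r , inj₂ eq) = r , inj₁ eq
    nz' : ¬ T (Zb b ∧ Zb a)
    nz' q = nz (∧T {Zb a} (proj₂ (T∧ {Zb b} q)) (proj₁ (T∧ {Zb b} q)))
    main : Adj R (inj₁ (φ (a , pa))) (inj₁ (φ (b , pb)))
    main with decT (adjGb a b)
    ... | yes q with anyF-elim _ q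
    ...   | e , h with T∨ {e1 e == a ∧ e2 e == b} h
    ...     | inj₁ z with ==→≡ (proj₁ (T∧ {e1 e == a} z)) | ==→≡ (proj₂ (T∧ {e1 e == a} z))
    ...       | refl | refl = mkAdj pa pb (inj₁ (e , pa , pb)) (notT nz) (inj₁ refl)
    main | yes q | e , h | inj₂ z with ==→≡ (proj₁ (T∧ {e1 e == b} z)) | ==→≡ (proj₂ (T∧ {e1 e == b} z))
    ...       | refl | refl = mkAdj pa pb (inj₁ (e , pb , pa)) (notT nz') (inj₂ refl)
    main | no nq with decT (toℕ a <ᵇ toℕ b)
    ... | yes lt = clique-edge pa pb ch na nb nz lt nq
    ... | no nlt = swapAdj (clique-edge pb pa ch nb na nz' lt' (λ q → nq (adjGb-sym b a q)))
      where
      lt' : T (toℕ b <ᵇ toℕ a)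
      lt' with <-cmp (toℕ b) (toℕ a)
      ... | tri< l _ _ = <⇒<ᵇ l
      ... | tri≈ _ e _ = ⊥-elim (ab (sym (Data.Fin.Properties.toℕ-injective e)))
        where import Data.Fin.Properties
      ... | tri> _ _ g = ⊥-elim (nlt (<⇒<ᵇ g))

  N-small : ∀ i → AtMost η (λ x → Adj R (inj₂ i) x)
  N-small i with decT (childb i)
  ... | yes ci = AtMost-inj {Q = λ v → T (X i v ∧ X t v)} (λ x p → proj₁ (adjI i x p)) inj hq
                   (AtMost-mono (adh i t (adj-sym t i (proj₁ (childb→ ci)))) (AtMost-countF _))
    where
    inj : ∀ x y p q → proj₁ (adjI i x p) ≡ proj₁ (adjI i y q) → x ≡ y
    inj x y p q eq with adjI i x p | adjI i y q
    ... | v , pv , refl , _ | w , pw , refl , _ = lem eq pv pw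
      where
      lem : ∀ {v w} → v ≡ w → (pv : T (X t v)) (pw : T (X t w)) → _≡_ {A = VR} (inj₁ (φ (v , pv))) (inj₁ (φ (w , pw)))
      lem {v} refl pv pw = cong inj₁ (φ-irr v pv pw)
    hq : ∀ x p → T (X i (proj₁ (adjI i x p)) ∧ X t (proj₁ (adjI i x p)))
    hq x p with adjI i x p
    ... | v , pv , _ , _ , nb = ∧T {X i v} (proj₂ (Nb→ nb)) (proj₁ (Nb→ nb))
  ... | no nci = AtMost-mono z≤n (AtMost-empty (λ x p → nci (→childb (proj₁ (proj₂ (proj₂ (proj₂ (adjI i x p))))))))

  emapK : ∀ ε (kd : EKind ε) → ekind ε ≡ kd → E R
  emapK ε (eH p1 p2 kp _ _) _ = inj₁ (inj₁ (εe ε , p1 , p2) , kp)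
  emapK ε (eF1 _ _ _ _ _ _) eq = inj₂ (ε , subst IsF (sym eq) tt)
  emapK ε (eF2 _ _ _ _ _ _) eq = inj₂ (ε , subst IsF (sym eq) tt)

  emap : EC → E R
  emap ε = emapK ε (ekind ε) refl

  IsF-irr : ∀ {ε} (kd : EKind ε) (w w' : IsF kd) → w ≡ w'
  IsF-irr (eF1 _ _ _ _ _ _) tt tt = refl
  IsF-irr (eF2 _ _ _ _ _ _) tt tt = refl

  F-eq : ∀ {ε ε'} {w : IsF (ekind ε)} {w' : IsF (ekind ε')} → ε ≡ ε' → _≡_ {A = F} (ε , w) (ε' , w')
  F-eq {ε} {w = w} {w'} refl = cong (ε ,_) (IsF-irr (ekind ε) w w')

  Hedge-e : E H → Fin m ⊎ ⊤
  Hedge-e (inj₁ (e , _) , _) = inj₁ e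
  Hedge-e (inj₂ _ , _) = inj₂ tt

  emap-injK : ∀ ε kd eq ε' kd' eq' → emapK ε kd eq ≡ emapK ε' kd' eq' → ε ≡ ε'
  emapK-injH : ∀ ε p1 p2 kp g1 g2 eq ε' kd' eq' → emapK ε (eH p1 p2 kp g1 g2) eq ≡ emapK ε' kd' eq' → ε ≡ ε'
  emapK-injH ε p1 p2 kp g1 g2 eq ε' (eH _ _ _ _ _) eq' e =
    tcd-uniq ε ε' (inj₁-injective (cong Hedge-e (inj₁-injective e)))
  emapK-injH ε p1 p2 kp g1 g2 eq ε' (eF1 _ _ _ _ _ _) eq' ()
  emapK-injH ε p1 p2 kp g1 g2 eq ε' (eF2 _ _ _ _ _ _) eq' ()
  emap-injK ε (eH p1 p2 kp g1 g2) eq ε' kd' eq' e = emapK-injH ε p1 p2 kp g1 g2 eq ε' kd' eq' e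
  emap-injK ε (eF1 _ _ _ _ _ _) eq ε' (eH p1 p2 kp g1 g2) eq' e = sym (emapK-injH ε' p1 p2 kp g1 g2 eq' ε _ eq (sym e))
  emap-injK ε (eF2 _ _ _ _ _ _) eq ε' (eH p1 p2 kp g1 g2) eq' e = sym (emapK-injH ε' p1 p2 kp g1 g2 eq' ε _ eq (sym e))
  emap-injK ε (eF1 _ _ _ _ _ _) eq ε' (eF1 _ _ _ _ _ _) eq' e = cong proj₁ (inj₂-injective e)
  emap-injK ε (eF1 _ _ _ _ _ _) eq ε' (eF2 _ _ _ _ _ _) eq' e = cong proj₁ (inj₂-injective e)
  emap-injK ε (eF2 _ _ _ _ _ _) eq ε' (eF1 _ _ _ _ _ _) eq' e = cong proj₁ (inj₂-injective e)
  emap-injK ε (eF2 _ _ _ _ _ _) eq ε' (eF2 _ _ _ _ _ _) eq' e = cong proj₁ (inj₂-injective e)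

  ends-okK : ∀ ε kd eq → (ends R (emapK ε kd eq) ≡ map vmap vmap (ends TCD ε))
                       ⊎ (ends R (emapK ε kd eq) ≡ swap (map vmap vmap (ends TCD ε)))
  ends-okK ε (eH p1 p2 kp g1 g2) eq = inj₁ (cong₂ _,_ (sym (g1 p1)) (sym (g2 p2)))
  ends-okK ε (eF1 _ _ _ _ _ _) eq = inj₁ refl
  ends-okK ε (eF2 _ _ _ _ _ _) eq = inj₁ refl

  TCD⊑R : TCD ⊑ R
  TCD⊑R = record
    { vmap = vmap
    ; emap = emap
    ; vmap-inj = vmap-inj
    ; emap-inj = λ ε ε' e → emap-injK ε (ekind ε) refl ε' (ekind ε') refl e
    ; ends-ok = λ ε → ends-okK ε (ekind ε) refl
    }

  Rt : RConstruction η Tor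
  Rt = record
    { H = H ; H⊑Tor = H⊑Tor ; Z = ZH ; Z-small = Z-small ; Q = Q ; ident = ident
    ; I = Fin k ; F = F ; fe = fe ; F-incident = F-incident ; I-stable = I-stable
    ; N-clique = N-clique ; N-small = N-small }

-- Half-edges of R are coded
-- injectively by half-edges of G (G-edges of H and edges of F) or by
-- ordered pairs (virtual edges of H).  At a vertex u of X_t - Z the codes
-- are the ≤ d half-edges at u and the pairs (u, w) with w a partner of u
-- (a common member of some Nb c, ≤ d·e of them); at the identified vertex
-- the same for every u ∈ Z (|Z| ≤ η); at a new vertex c the half-edges
-- with other end in X_c ∩ X_t (≤ η·d).
module TorsoDegree (d e : ℕ) {n m : ℕ} (G : FinGraph n m) (maxdeg : MaxDeg≤ (toGraph G) d)
             {k : ℕ} (adj : Fin k → Fin k → Bool) (X : Fin k → Fin n → Bool)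
             (td : IsTreeDecomposition G adj X) (adh : TDAdhesion≤ G adj X (suc e)) (r : Fin k)
             (t : Fin k) where
  open IsTreeDecomposition td
  η : ℕ
  η = suc e
  open Construction d η G maxdeg adj X td adh r
  open TorsoModel d η G maxdeg adj X td adh r t

  endG : Fin m × Bool → Fin n
  endG = end (toGraph G)

  HE : Set
  HE = E R × Bool

  Code : Set
  Code = (Fin m × Bool) ⊎ (Fin n × Fin n)

  code : HE → Code
  code (inj₁ (inj₁ (e , _) , _) , b) = inj₁ (e , b)
  code (inj₁ (inj₂ ((a1 , a2) , _) , _) , true) = inj₂ (a1 , a2)
  code (inj₁ (inj₂ ((a1 , a2) , _) , _) , false) = inj₂ (a2 , a1)
  code (inj₂ (ε , _) , b) = inj₁ (εe ε , b)

  F-edge-leaves-Xt : ∀ ε (w : IsF (ekind ε)) → ¬ T (X t (e1 (εe ε))) ⊎ ¬ T (X t (e2 (εe ε)))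
  F-edge-leaves-Xt ε w with ekind ε
  ... | eF1 _ _ _ nx _ _ = inj₁ nx
  ... | eF2 _ _ _ nx _ _ = inj₂ nx

  H-edge≢F-edge : ∀ e (p1 : T (X t (e1 e))) (p2 : T (X t (e2 e))) ε (w : IsF (ekind ε)) → e ≢ εe ε
  H-edge≢F-edge e p1 p2 ε w refl with F-edge-leaves-Xt ε w
  ... | inj₁ nx = nx p1
  ... | inj₂ nx = nx p2

  T⁵-irrelevant : ∀ {b1 b2 b3 b4 b5 : Bool} (q q' : T b1 × T b2 × T b3 × T b4 × T b5) → q ≡ q'
  T⁵-irrelevant (a , b , c , d , e) (a' , b' , c' , d' , e')
    rewrite T-irrelevant a a' | T-irrelevant b b' | T-irrelevant c c' | T-irrelevant d d' | T-irrelevant e e' = refl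

  lt-asym : ∀ {a b : ℕ} → T (a <ᵇ b) → T (b <ᵇ a) → ⊥
  lt-asym {a} {b} p q = <-asym (<ᵇ⇒< a b p) (<ᵇ⇒< b a q)

  code-inj : ∀ h h' → code h ≡ code h' → h ≡ h'
  code-inj (inj₁ (inj₁ (e , p1 , p2) , kp) , b) (inj₁ (inj₁ (.e , p1' , p2') , kp') , .b) refl =
    cong (λ z → (inj₁ z , b)) (cong₂ (λ u v → (inj₁ (e , u) , v)) (cong₂ _,_ (T-irrelevant p1 p1') (T-irrelevant p2 p2')) (T-irrelevant kp kp'))
  code-inj (inj₁ (inj₁ (e , p1 , p2) , kp) , b) (inj₁ (inj₂ _ , _) , true) ()
  code-inj (inj₁ (inj₁ (e , p1 , p2) , kp) , b) (inj₁ (inj₂ _ , _) , false) ()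
  code-inj (inj₁ (inj₁ (e , p1 , p2) , kp) , b) (inj₂ (ε , w) , b') eq =
    ⊥-elim (H-edge≢F-edge e p1 p2 ε w (proj₁ (Prod.,-injective (inj₁-injective eq))))
  code-inj (inj₁ (inj₂ _ , _) , true) (inj₁ (inj₁ _ , _) , _) ()
  code-inj (inj₁ (inj₂ _ , _) , false) (inj₁ (inj₁ _ , _) , _) ()
  code-inj (inj₁ (inj₂ _ , _) , true) (inj₂ _ , _) ()
  code-inj (inj₁ (inj₂ _ , _) , false) (inj₂ _ , _) ()
  code-inj (inj₁ (inj₂ ((a1 , a2) , q) , kp) , true) (inj₁ (inj₂ ((.a1 , .a2) , q') , kp') , true) refl =
    cong (λ z → (inj₁ z , true)) (cong₂ (λ u v → (inj₂ ((a1 , a2) , u) , v)) (T⁵-irrelevant q q') (T-irrelevant kp kp'))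
  code-inj (inj₁ (inj₂ ((a1 , a2) , q) , kp) , false) (inj₁ (inj₂ ((.a1 , .a2) , q') , kp') , false) refl =
    cong (λ z → (inj₁ z , false)) (cong₂ (λ u v → (inj₂ ((a1 , a2) , u) , v)) (T⁵-irrelevant q q') (T-irrelevant kp kp'))
  code-inj (inj₁ (inj₂ ((a1 , a2) , q) , kp) , true) (inj₁ (inj₂ ((.a2 , .a1) , q') , kp') , false) refl =
    ⊥-elim (lt-asym {toℕ a1} {toℕ a2} (proj₁ (proj₂ (proj₂ q))) (proj₁ (proj₂ (proj₂ q'))))
  code-inj (inj₁ (inj₂ ((a1 , a2) , q) , kp) , false) (inj₁ (inj₂ ((.a2 , .a1) , q') , kp') , true) refl =
    ⊥-elim (lt-asym {toℕ a1} {toℕ a2} (proj₁ (proj₂ (proj₂ q))) (proj₁ (proj₂ (proj₂ q'))))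
  code-inj (inj₂ (ε , w) , b) (inj₁ (inj₁ (e , p1 , p2) , kp) , b') eq =
    ⊥-elim (H-edge≢F-edge e p1 p2 ε w (sym (proj₁ (Prod.,-injective (inj₁-injective eq)))))
  code-inj (inj₂ (ε , w) , b) (inj₁ (inj₂ _ , _) , true) ()
  code-inj (inj₂ (ε , w) , b) (inj₁ (inj₂ _ , _) , false) ()
  code-inj (inj₂ (ε , w) , b) (inj₂ (ε' , w') , b') eq with Prod.,-injective (inj₁-injective eq)
  ... | e≡ , refl = cong (λ z → (inj₂ z , b)) (F-eq (tcd-uniq ε ε' e≡))

  φ-inj₂ : ∀ {a pa u q} → φ (a , pa) ≡ inj₂ (u , q) → a ≡ u
  φ-inj₂ {a} {pa} {u} {q} eq = go (decT (Zb a))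
    where
    lem : ∀ {a u p q} → _≡_ {A = VQ} (inj₂ (a , p)) (inj₂ (u , q)) → a ≡ u
    lem refl = refl
    go : Dec (T (Zb a)) → a ≡ u
    go (yes z) = ⊥-elim (inj₁≢inj₂ (trans (sym (proj₂ (φ-Z a pa z))) eq))
    go (no nz) = lem (trans (sym (proj₂ (φ-nZ a pa nz))) eq)

  φ-inj₁ : ∀ {a pa pz} → φ (a , pa) ≡ inj₁ pz → T (Zb a)
  φ-inj₁ {a} {pa} eq = go (decT (Zb a))
    where
    go : Dec (T (Zb a)) → T (Zb a)
    go (yes z) = z
    go (no nz) = ⊥-elim (inj₁≢inj₂ (trans (sym eq) (proj₂ (φ-nZ a pa nz))))

  partner : Fin n → Fin n → Bool
  partner u w = anyF (λ c → (childb c ∧ Nb c u) ∧ (Nb c w ∧ not (w == u)))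

  mkPartner : ∀ {c u w} → T (childb c) → T (Nb c u) → T (Nb c w) → w ≢ u → T (partner u w)
  mkPartner {c} {u} {w} ch nu nw ne =
    anyF-intro _ c (∧T {childb c ∧ Nb c u} (∧T {childb c} ch nu) (∧T {Nb c w} nw (notT (λ q → ne (==→≡ q)))))

  lt-ne : ∀ {a b : Fin n} → T (toℕ a <ᵇ toℕ b) → a ≢ b
  lt-ne {a} {b} p refl = <-irrefl refl (<ᵇ⇒< (toℕ a) (toℕ a) p)

  hc-partner : ∀ {a1 a2} → T (not (Zb a1 ∧ Zb a2) ∧ anyF (λ c → childb c ∧ Nb c a1 ∧ Nb c a2)) →
    a1 ≢ a2 → T (partner a1 a2) × T (partner a2 a1)
  hc-partner {a1} {a2} kp ne with anyF-elim _ (proj₂ (T∧ {not (Zb a1 ∧ Zb a2)} kp))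
  ... | c , q with T∧ {childb c} q
  ... | ch , q2 with T∧ {Nb c a1} q2
  ... | n1 , n2 = mkPartner ch n1 n2 (λ eq → ne (sym eq)) , mkPartner ch n2 n1 ne

  -- u lies in Nb c for at most d children c: each c uses its own edge at u
  children-count : ∀ u → countF (λ c → childb c ∧ Nb c u) ≤ d
  children-count u = countF-AtMost _ (AtMost-inj f inj hq (maxdeg u))
    where
    f : ∀ c → T (childb c ∧ Nb c u) → Fin m × Bool
    f c p = proj₁ (crossInfo c u (Nb-cross (proj₂ (T∧ {childb c} p))))
    hq : ∀ c p → end (toGraph G) (f c p) ≡ u
    hq c p = proj₁ (proj₂ (crossInfo c u (Nb-cross (proj₂ (T∧ {childb c} p)))))
    inj : ∀ c c' p p' → f c p ≡ f c' p' → c ≡ c'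
    inj c c' p p' eq with c Fin.≟ c'
    ... | yes q = q
    ... | no ne = ⊥-elim (sides-disj (proj₁ (childb→ (proj₁ (T∧ {childb c} p)))) (proj₁ (childb→ (proj₁ (T∧ {childb c'} p')))) ne
                    s1 (subst (λ h → Side c' t (home (end (toGraph G) (proj₁ h , not (proj₂ h))))) (sym eq) s2))
      where
      s1 : Side c t (home (end (toGraph G) (proj₁ (f c p) , not (proj₂ (f c p)))))
      s1 = proj₂ (proj₂ (crossInfo c u (Nb-cross (proj₂ (T∧ {childb c} p)))))
      s2 : Side c' t (home (end (toGraph G) (proj₁ (f c' p') , not (proj₂ (f c' p')))))
      s2 = proj₂ (proj₂ (crossInfo c' u (Nb-cross (proj₂ (T∧ {childb c'} p')))))

  partner-count : ∀ u → countF (partner u) ≤ d * e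
  partner-count u = ≤-trans (countF-anyF (λ c → childb c ∧ Nb c u) (λ c w → Nb c w ∧ not (w == u)) e hyp)
                      (*-monoˡ-≤ e (children-count u))
    where
    hyp : ∀ c → T (childb c ∧ Nb c u) → countF (λ w → Nb c w ∧ not (w == u)) ≤ e
    hyp c p = pred-mono-≤ (≤-trans (countF-strict (λ w → Nb c w ∧ not (w == u)) (Nb c) (λ x q → proj₁ (T∧ {Nb c x} q)) u
                 (proj₂ (T∧ {childb c} p)) (λ q → Tnot (proj₂ (T∧ {Nb c u} q)) (==refl u)))
                 (≤-trans (countF-mono (Nb c) (λ v → X t v ∧ X c v) (λ x q → ∧T {X t x} (proj₁ (Nb→ q)) (proj₂ (Nb→ q))))
                    (adh t c (proj₁ (childb→ (proj₁ (T∧ {childb c} p)))))))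

  QB : Fin n → Code → Set
  QB u (inj₁ h) = endG h ≡ u
  QB u (inj₂ (w , w')) = (w ≡ u) × T (partner u w')

  QC : Code → Set
  QC (inj₁ h) = T (Zb (endG h))
  QC (inj₂ (w , w')) = T (Zb w) × T (partner w w')

  endNot : Fin m × Bool → Fin n
  endNot (e , b) = endG (e , not b)

  childShared : Fin k → Fin n → Bool
  childShared c v = childb c ∧ (X c v ∧ X t v)

  QA : Fin k → Code → Set
  QA c (inj₁ h) = T (childShared c (endNot h))
  QA c (inj₂ _) = ⊥

  codes-at-plain : ∀ u pu h → end R h ≡ inj₁ (inj₂ (u , pu)) → QB u (code h)
  codes-at-plain u pu (inj₁ (inj₁ (e , p1 , p2) , kp) , true) eq = φ-inj₂ (inj₁-injective eq)
  codes-at-plain u pu (inj₁ (inj₁ (e , p1 , p2) , kp) , false) eq = φ-inj₂ (inj₁-injective eq)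
  codes-at-plain u pu (inj₁ (inj₂ ((a1 , a2) , pa1 , pa2 , lt , _) , kp) , true) eq with φ-inj₂ (inj₁-injective eq)
  ... | refl = refl , proj₁ (hc-partner kp (lt-ne lt))
  codes-at-plain u pu (inj₁ (inj₂ ((a1 , a2) , pa1 , pa2 , lt , _) , kp) , false) eq with φ-inj₂ (inj₁-injective eq)
  ... | refl = refl , proj₂ (hc-partner kp (lt-ne lt))
  codes-at-plain u pu (inj₂ (ε , w) , true) eq with ekind ε
  ... | eF1 c ch m nx g nb = ⊥-elim (inj₁≢inj₂ (trans (sym eq) m))
  ... | eF2 c ch m nx g nb = φ-inj₂ (inj₁-injective (trans (sym (g (proj₁ (Nb→ nb)))) eq))
  codes-at-plain u pu (inj₂ (ε , w) , false) eq with ekind ε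
  ... | eF1 c ch m nx g nb = φ-inj₂ (inj₁-injective (trans (sym (g (proj₁ (Nb→ nb)))) eq))
  ... | eF2 c ch m nx g nb = ⊥-elim (inj₁≢inj₂ (trans (sym eq) m))

  codes-at-identified : ∀ pz h → end R h ≡ inj₁ (inj₁ pz) → QC (code h)
  codes-at-identified pz (inj₁ (inj₁ (e , p1 , p2) , kp) , true) eq = φ-inj₁ (inj₁-injective eq)
  codes-at-identified pz (inj₁ (inj₁ (e , p1 , p2) , kp) , false) eq = φ-inj₁ (inj₁-injective eq)
  codes-at-identified pz (inj₁ (inj₂ ((a1 , a2) , pa1 , pa2 , lt , _) , kp) , true) eq =
    φ-inj₁ (inj₁-injective eq) , proj₁ (hc-partner kp (lt-ne lt))
  codes-at-identified pz (inj₁ (inj₂ ((a1 , a2) , pa1 , pa2 , lt , _) , kp) , false) eq =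
    φ-inj₁ (inj₁-injective eq) , proj₂ (hc-partner kp (lt-ne lt))
  codes-at-identified pz (inj₂ (ε , w) , true) eq with ekind ε
  ... | eF1 c ch m nx g nb = ⊥-elim (inj₁≢inj₂ (trans (sym eq) m))
  ... | eF2 c ch m nx g nb = φ-inj₁ (inj₁-injective (trans (sym (g (proj₁ (Nb→ nb)))) eq))
  codes-at-identified pz (inj₂ (ε , w) , false) eq with ekind ε
  ... | eF1 c ch m nx g nb = φ-inj₁ (inj₁-injective (trans (sym (g (proj₁ (Nb→ nb)))) eq))
  ... | eF2 c ch m nx g nb = ⊥-elim (inj₁≢inj₂ (trans (sym eq) m))

  attachment-code : ∀ {c c' v} → c' ≡ c → IsChild c' → T (Nb c' v) → T (childShared c v)
  attachment-code {c} {.c} {v} refl ch nb = ∧T {childb c} (→childb ch) (∧T {X c v} (proj₂ (Nb→ nb)) (proj₁ (Nb→ nb)))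

  codes-at-new : ∀ c h → end R h ≡ inj₂ c → QA c (code h)
  codes-at-new c (inj₁ (inj₁ (e , p1 , p2) , kp) , true) eq = ⊥-elim (inj₁≢inj₂ eq)
  codes-at-new c (inj₁ (inj₁ (e , p1 , p2) , kp) , false) eq = ⊥-elim (inj₁≢inj₂ eq)
  codes-at-new c (inj₁ (inj₂ _ , kp) , true) eq = ⊥-elim (inj₁≢inj₂ eq)
  codes-at-new c (inj₁ (inj₂ _ , kp) , false) eq = ⊥-elim (inj₁≢inj₂ eq)
  codes-at-new c (inj₂ (ε , w) , true) eq with ekind ε
  ... | eF1 c' ch m nx g nb = attachment-code (inj₂-injective (trans (sym m) eq)) ch nb
  ... | eF2 c' ch m nx g nb = ⊥-elim (inj₁≢inj₂ (trans (sym (g (proj₁ (Nb→ nb)))) eq))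
  codes-at-new c (inj₂ (ε , w) , false) eq with ekind ε
  ... | eF1 c' ch m nx g nb = ⊥-elim (inj₁≢inj₂ (trans (sym (g (proj₁ (Nb→ nb)))) eq))
  ... | eF2 c' ch m nx g nb = attachment-code (inj₂-injective (trans (sym m) eq)) ch nb

  new-vertex-attachments : ∀ c → countF (childShared c) ≤ suc e
  new-vertex-attachments c with decT (childb c)
  ... | yes ch = ≤-trans (countF-mono (childShared c) (λ v → X c v ∧ X t v) (λ v q → proj₂ (T∧ {childb c} q)))
                   (adh c t (adj-sym t c (proj₁ (childb→ ch))))
  ... | no nch = subst (_≤ suc e) (sym (countF-false (childShared c) (λ v q → nch (proj₁ (T∧ {childb c} q))))) z≤n

  new-vertex-codes : ∀ c → AtMost (suc e * d) (λ h → T (childShared c (endNot h)))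
  new-vertex-codes c = AtMost-mono (*-monoˡ-≤ d (new-vertex-attachments c))
              (AtMost-sub (λ h p → p , tt) (AtMost-bySet endNot (λ _ → ⊤) d (childShared c) per))
    where
    per : ∀ a → T (childShared c a) → AtMost d (λ h → endNot h ≡ a × ⊤)
    per a _ = AtMost-inj (λ h _ → (proj₁ h , not (proj₂ h))) inj (λ h p → proj₁ p) (maxdeg a)
      where
      inj : ∀ (x y : Fin m × Bool) p q → (proj₁ x , not (proj₂ x)) ≡ (proj₁ y , not (proj₂ y)) → x ≡ y
      inj (e1' , b1) (e2' , b2) p q eq with Prod.,-injective eq
      ... | refl , nb = cong (e1' ,_) (not-injective nb)

  plain-partner-codes : ∀ u → AtMost (d * e) (λ ww → (proj₁ ww ≡ u) × T (partner u (proj₂ ww)))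
  plain-partner-codes u = AtMost-inj (λ ww _ → proj₂ ww) inj (λ ww p → proj₂ p)
              (AtMost-mono (partner-count u) (AtMost-countF (partner u)))
    where
    inj : ∀ (x y : Fin n × Fin n) p q → proj₂ x ≡ proj₂ y → x ≡ y
    inj (w1 , w1') (w2 , w2') (refl , _) (refl , _) refl = refl

  Z-halfedges : AtMost (countF Zb * d) (λ h → T (Zb (endG h)))
  Z-halfedges = AtMost-sub (λ h p → p , tt)
             (AtMost-bySet endG (λ _ → ⊤) d Zb (λ a _ → AtMost-sub (λ h p → proj₁ p) (maxdeg a)))

  Z-partner-codes : AtMost (countF Zb * (d * e)) (λ ww → T (Zb (proj₁ ww)) × T (partner (proj₁ ww) (proj₂ ww)))
  Z-partner-codes = AtMost-bySet proj₁ (λ ww → T (partner (proj₁ ww) (proj₂ ww))) (d * e) Zb per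
    where
    per : ∀ a → T (Zb a) → AtMost (d * e) (λ ww → proj₁ ww ≡ a × T (partner (proj₁ ww) (proj₂ ww)))
    per a _ = AtMost-inj (λ ww _ → proj₂ ww) inj hq (AtMost-mono (partner-count a) (AtMost-countF (partner a)))
      where
      inj : ∀ (x y : Fin n × Fin n) p q → proj₂ x ≡ proj₂ y → x ≡ y
      inj (w1 , w1') (w2 , w2') (refl , _) (refl , _) refl = refl
      hq : ∀ (ww : Fin n × Fin n) → proj₁ ww ≡ a × T (partner (proj₁ ww) (proj₂ ww)) → T (partner a (proj₂ ww))
      hq (w , w') (refl , p) = p

  maxdegR : MaxDeg≤ R ((d + 1) * η * η + d)
  maxdegR (inj₂ c) = AtMost-mono (bound-child d e)
    (AtMost-inj (λ h _ → code h) (λ x y _ _ → code-inj x y) (codes-at-new c) (AtMost-⊎ {P = QA c} (new-vertex-codes c) (AtMost-empty (λ x ()))))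
  maxdegR (inj₁ (inj₂ (u , pu))) = AtMost-mono (bound-plain d e)
    (AtMost-inj (λ h _ → code h) (λ x y _ _ → code-inj x y) (codes-at-plain u pu) (AtMost-⊎ {P = QB u} (maxdeg u) (plain-partner-codes u)))
  maxdegR (inj₁ (inj₁ pz)) = AtMost-mono (bound-identified d e)
    (AtMost-inj (λ h _ → code h) (λ x y _ _ → code-inj x y) (codes-at-identified pz)
      (AtMost-mono (+-mono-≤ (*-monoˡ-≤ d Z-count) (*-monoˡ-≤ (d * e) Z-count)) (AtMost-⊎ {P = QC} Z-halfedges Z-partner-codes)))

root : ∀ {k} → 1 ≤ k → Fin k
root {suc k} _ = zero

lemma5p2 : (d η : ℕ) → 1 ≤ d → 1 ≤ η →
    (n m : ℕ) (G : FinGraph n m) → MaxDeg≤ (toGraph G) d →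
    (k : ℕ) (adj : Fin k → Fin k → Bool) (X : Fin k → Fin n → Bool) →
    IsTreeDecomposition G adj X → TDAdhesion≤ G adj X η →
    Σ ℕ λ l → Σ (Fin (k + l) → Fin (k + l) → Bool) λ adj' → Σ (Fin n → Fin (k + l)) λ π →
    IsTree adj'
    × TCDAdhesion≤ G adj' π ((d + 1) * (d + 1) * η + d)
    × AttachLeaves adj adj'
    × (∀ t → AtMost 1 (λ v → π v ≡ t) × (∀ v → π v ≡ t → IsLeaf adj' t))
    × (∀ t → Σ (RConstruction η (torsoTD G adj X t)) λ Rt →
    (torsoTCD G adj' π (t ↑ˡ l) ⊑ RConstruction.R Rt)
    × MaxDeg≤ (RConstruction.R Rt) ((d + 1) * η * η + d))
lemma5p2 d .(suc e) _ (s≤s {n = e} z≤n) n m G maxdeg k adj X td adh =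
  n , adj' , π , tree' , adhesion , attach , small-bags , torsos
  where
  open IsTreeDecomposition td
  r : Fin k
  r = root (IsTree.nonempty tree)
  open Construction d (suc e) G maxdeg adj X td adh r
  torsos : ∀ t → Σ (RConstruction (suc e) (torsoTD G adj X t)) λ Rt →
    (torsoTCD G adj' π (t ↑ˡ n) ⊑ RConstruction.R Rt)
    × MaxDeg≤ (RConstruction.R Rt) ((d + 1) * suc e * suc e + d)
  torsos t = TorsoModel.Rt d (suc e) G maxdeg adj X td adh r t
           , TorsoModel.TCD⊑R d (suc e) G maxdeg adj X td adh r t
           , TorsoDegree.maxdegR d e G maxdeg adj X td adh r t
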